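{- Let $P$ be a finite set and $\mathcal{T}\subseteq 2^P$ a set system whose union is $P$ and which satisfies the complement condition. Then for every $(S^*,\mathcal{U}^*)\in\mathcal{C}^*$ there exists a cost function $c:\mathcal{T}\to\mathbb{R}_{\ge0}$ such that the family $\mathcal{C}^{\mathrm{simple}}\setminus\{(S^*,\mathcal{U}^*)\}$ does not determine the happy nucleolus of the set covering instance $(P,\mathcal{T},c)$.
   Context: A set covering instance $(P,\mathcal{T},c)$ consists of a finite set $P$, a family $\mathcal{T}$ of subsets of $P$ whose union is $P$, and costs $c:\mathcal{T}\to\mathbb{R}_{\ge 0}$. For $\mathcal{U}\subseteq\mathcal{T}$ write $c(\mathcal{U})=\sum_{T\in\mathcal{U}}c(T)$; $\mathcal{U}$ covers $S\subseteq P$ if every element of $S$ lies in some set of $\mathcal{U}$. For $y\in\mathbb{R}^P$ write $y(S)=\sum_{p\in S}y_p$. A coalition is a nonempty subset of $P$. Let $\mathcal{C}$ be the set of pairs $(S,\mathcal{U})$ with $\emptyset\ne S\subseteq P$, $\mathcal{U}\subseteq\mathcal{T}$ covering $S$; $\mathcal{C}^{\mathrm{simple}}=\{(S,\mathcal{U})\in\mathcal{C}:|\mathcal{U}|=1\}$; and $\mathcal{C}^*=\{(S,\{T\}): T\in\mathcal{T},\ S\notin\{\emptyset,P\},\ S=T\text{ or }S=T\setminus\{p\}\text{ for some }p\in T\}$. For $y\in\mathbb{R}^P_{\ge0}$, $\theta^y(S,\mathcal{U})=c(\mathcal{U})-y(S)$; $\theta^y(S)=\min\{\theta^y(S,\mathcal{U}):\mathcal{U}\subseteq\mathcal{T}\text{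 covers }S\}$; the excess vector $\theta^y$ lists $\theta^y(S)$ over all coalitions in nondecreasing order; for $\mathcal{C}'\subseteq\mathcal{C}$, $\theta^y[\mathcal{C}']$ lists $\theta^y(S,\mathcal{U})$ for $(S,\mathcal{U})\in\mathcal{C}'$ in nondecreasing order. $\mathrm{LP}(P,\mathcal{T},c)=\min\{\sum_{T}c(T)x_T: x\in\mathbb{R}^{\mathcal{T}}_{\ge0},\ \sum_{T\ni p}x_T\ge1\ \forall p\in P\}$. The happy nucleolus is the (unique) $y\in\mathbb{R}^P_{\ge0}$ with $y(P)=\mathrm{LP}(P,\mathcal{T},c)$ lexicographically maximizing $\theta^y$ among such vectors. A family $\mathcal{C}'\subseteq\mathcal{C}$ determines the happy nucleolus if the happy nucleolus is the unique vector lexicographically maximizing $\theta^y[\mathcal{C}']$ among all $y\in\mathbb{R}^P_{\ge0}$ with $y(P)=\mathrm{LP}(P,\mathcal{T},c)$. The set system $\mathcal{T}$ satisfies the complement condition if for every $T\in\mathcal{T}$ there exists $\mathcal{U}\subseteq\mathcal{T}\cap 2^{P\setminus T}$ that covers $P\setminus T$.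
   Formalization: The costs c, the payoff vectors y in the happy nucleolus and in determination, and the LP variables x are taken in ℚ instead of ℝ. -}

module Defs where

open import Data.Bool using (Bool; true; false; if_then_else_; not; _∧_)
open import Data.Nat using (ℕ; zero; suc)
open import Data.Fin using (Fin; zero; suc)
open import Data.Fin.Subset using (Subset; inside; outside; _∈_; _⊆_; _∪_; ∁; ⁅_⁆)
  renaming (⊥ to ∅ₛ; ⊤ to Pₛ; _-_ to _∖ₛ_)
open import Data.Fin.Subset.Properties using (_⊆?_)
open import Data.Vec using (Vec; []; _∷_; lookup)
open import Data.Vec.Properties using (≡-dec)
open import Data.List using (List; []; _∷_; map; _++_; filter; foldr; concatMap)
open import Data.List.Membership.Propositional renaming (_∈_ to _∈ₗ_)
open import Data.Product using (Σ; ∃; _×_; _,_; proj₁; proj₂)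
open import Data.Sum using (_⊎_)
open import Data.Empty using (⊥)
open import Data.Unit using (⊤)
open import Relation.Nullary using (¬_; Dec; yes; no; ¬?)
open import Relation.Nullary.Decidable using (_×-dec_)
open import Relation.Binary.PropositionalEquality using (_≡_; _≢_)
open import Data.Rational using (ℚ; 0ℚ; 1ℚ; _+_; _*_; _-_; _≤_; _<_; _⊓_)
open import Data.Rational.Properties using (≤-decTotalOrder)
import Data.Bool.Properties as BoolP
import Data.Fin.Properties as FinP
open import Data.List.Sort ≤-decTotalOrder using (sort)

-- The set system 𝒯 is an indexed family
-- T : Fin m → Subset n (required to be injective in the theorem, so it
-- is a genuine set of subsets).  A subfamily 𝒰 ⊆ 𝒯 is a Subset m of
-- indices.

sumFin : ∀ {k} → (Fin k → ℚ) → ℚ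
sumFin {zero}  f = 0ℚ
sumFin {suc k} f = f zero + sumFin (λ i → f (suc i))

allSubsets : ∀ k → List (Subset k)
allSubsets zero    = [] ∷ []
allSubsets (suc k) = map (outside ∷_) (allSubsets k) ++ map (inside ∷_) (allSubsets k)

sumOn : ∀ {k} → (Fin k → ℚ) → Subset k → ℚ
sumOn f S = sumFin (λ i → if lookup S i then f i else 0ℚ)

unionOf : ∀ {n m} → (Fin m → Subset n) → Subset m → Subset n
unionOf {m = zero}  T []      = ∅ₛ
unionOf {m = suc m} T (b ∷ U) =
  (if b then T zero else ∅ₛ) ∪ unionOf (λ j → T (suc j)) U

Covers : ∀ {n m} → (Fin m → Subset n) → Subset n → Subset m → Set
Covers T S U = S ⊆ unionOf T U

costOf : ∀ {m} → (Fin m → ℚ) → Subset m → ℚ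
costOf c U = sumOn c U

-- minimum of a list (the empty list never occurs when ⋃𝒯 = P)
minList : List ℚ → ℚ
minList []       = 0ℚ
minList (x ∷ xs) = foldr _⊓_ x xs

isNonempty : ∀ {k} → Subset k → Bool
isNonempty []            = false
isNonempty (true ∷ S)    = true
isNonempty (false ∷ S)   = isNonempty S

coalitions : ∀ n → List (Subset n)
coalitions n = filter (λ S → isNonempty S BoolP.≟ true) (allSubsets n)

excessPair : ∀ {n m} → (Fin m → ℚ) → (Fin n → ℚ) → Subset n × Subset m → ℚ
excessPair c y (S , U) = costOf c U - sumOn y S

excess : ∀ {n m} → (Fin m → Subset n) → (Fin m → ℚ) → (Fin n → ℚ) → Subset n → ℚ
excess {n} {m} T c y S =
  minList (map (λ U → excessPair c y (S , U)) (filter (λ U → S ⊆? unionOf T U) (allSubsets m)))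

excessVector : ∀ {n m} → (Fin m → Subset n) → (Fin m → ℚ) → (Fin n → ℚ) → List ℚ
excessVector {n} T c y = sort (map (excess T c y) (coalitions n))

excessVectorOn : ∀ {n m} → List (Subset n × Subset m) → (Fin m → ℚ) → (Fin n → ℚ) → List ℚ
excessVectorOn C' c y = sort (map (excessPair c y) C')

-- lexicographic order on lists (used on lists of equal length)
_≤lex_ : List ℚ → List ℚ → Set
[]       ≤lex _        = ⊤
(x ∷ xs) ≤lex []       = ⊥
(x ∷ xs) ≤lex (z ∷ zs) = x < z ⊎ (x ≡ z × xs ≤lex zs)

LPFeasible : ∀ {n m} → (Fin m → Subset n) → (Fin m → ℚ) → Set
LPFeasible {n} T x =
  (∀ j → 0ℚ ≤ x j) × (∀ (p : Fin n) → 1ℚ ≤ sumFin (λ j → if lookup (T j) p then x j else 0ℚ))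

IsLPValue : ∀ {n m} → (Fin m → Subset n) → (Fin m → ℚ) → ℚ → Set
IsLPValue T c v =
  (∃ λ x → LPFeasible T x × sumFin (λ j → c j * x j) ≡ v)
  × (∀ x → LPFeasible T x → v ≤ sumFin (λ j → c j * x j))

Admissible : ∀ {n m} → (Fin m → Subset n) → (Fin m → ℚ) → (Fin n → ℚ) → Set
Admissible T c y = (∀ i → 0ℚ ≤ y i) × ∃ λ v → IsLPValue T c v × sumFin y ≡ v

IsHappyNucleolus : ∀ {n m} → (Fin m → Subset n) → (Fin m → ℚ) → (Fin n → ℚ) → Set
IsHappyNucleolus T c y =
  Admissible T c y × (∀ z → Admissible T c z → excessVector T c z ≤lex excessVector T c y)

IsLexMaxOn : ∀ {n m} → (Fin m → Subset n) → (Fin m → ℚ) → List (Subset n × Subset m) → (Fin n → ℚ) → Set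
IsLexMaxOn T c C' y =
  Admissible T c y × (∀ z → Admissible T c z → excessVectorOn C' c z ≤lex excessVectorOn C' c y)

Determines : ∀ {n m} → (Fin m → Subset n) → (Fin m → ℚ) → List (Subset n × Subset m) → Set
Determines T c C' =
  ∀ y → IsHappyNucleolus T c y →
    IsLexMaxOn T c C' y × (∀ z → IsLexMaxOn T c C' z → ∀ i → z i ≡ y i)

simpleFamily : ∀ {n m} → (Fin m → Subset n) → List (Subset n × Subset m)
simpleFamily {n} {m} T =
  concatMap (λ j → map (λ S → (S , ⁅ j ⁆))
                       (filter (λ S → (isNonempty S BoolP.≟ true) ×-dec (S ⊆? T j)) (allSubsets n)))
            (Data.List.allFin m)
  where import Data.List

pairEq? : ∀ {n m} (a b : Subset n × Subset m) → Dec (a ≡ b)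
pairEq? (S , U) (S' , U') with ≡-dec BoolP._≟_ S S' | ≡-dec BoolP._≟_ U U'
... | yes Relation.Binary.PropositionalEquality.refl | yes Relation.Binary.PropositionalEquality.refl = yes Relation.Binary.PropositionalEquality.refl
... | no ne | _ = no (λ { Relation.Binary.PropositionalEquality.refl → ne Relation.Binary.PropositionalEquality.refl })
... | yes _ | no ne = no (λ { Relation.Binary.PropositionalEquality.refl → ne Relation.Binary.PropositionalEquality.refl })

removePair : ∀ {n m} → List (Subset n × Subset m) → Subset n × Subset m → List (Subset n × Subset m)
removePair C' x = filter (λ a → ¬? (pairEq? a x)) C'

InCStar : ∀ {n m} → (Fin m → Subset n) → Subset n × Subset m → Set
InCStar T (S , U) =
  ∃ λ j → U ≡ ⁅ j ⁆ × S ≢ ∅ₛ × S ≢ Pₛ × (S ≡ T j ⊎ ∃ λ p → p ∈ T j × S ≡ T j ∖ₛ p)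

UnionIsAll : ∀ {n m} → (Fin m → Subset n) → Set
UnionIsAll {n} T = ∀ (p : Fin n) → ∃ λ j → p ∈ T j

ComplementCondition : ∀ {n m} → (Fin m → Subset n) → Set
ComplementCondition {n} {m} T =
  ∀ j → ∃ λ (U : Subset m) → (∀ k → k ∈ U → T k ⊆ ∁ (T j)) × Covers T (∁ (T j)) U

-- Let T* = T j* be the set of the removed pair, Q ⊆ P ∖ T* a second block, k = |T*| and l = |Q|.
-- Charge k for T*, k + l + 2 for every other set meeting T*, l for the other sets meeting Q, and 0
-- for the rest.  If the sets of cost 0 cover P ∖ (T* ∪ Q) and some cover of P ∖ T* costs at most l,
-- then a cheapest cover of S costs k·[S meets T*] + l·[S meets Q], the LP value is k + l, and the
-- happy nucleolus is the indicator vector y of T* ∪ Q.  The simple pairs other than (S*, {T*}) do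
-- not determine y because an admissible z beats y on them: on each of them z has excess at least
-- some w > 0 or y has excess 0, and on one pair where y has excess below w, z has excess w.
-- If S* = T* ∖ p*, take Q = ∅ and spread k evenly over T* ∖ p*; the pair is (T* ∖ p₁, {T*}).
-- If S* = T*, let D be the last member of the shortest prefix (in index order) of a complement cover
-- of T* that covers P ∖ T*, and Q the part of P ∖ T* that the earlier members miss; z moves ½ from a
-- point of Q to a point of T*, and the pair is (Q, {D}).

module Submission where

open import Defs
open import Data.Nat using (ℕ)
open import Data.Fin using (Fin)
open import Data.Fin.Subset using (Subset)
open import Data.Product using (∃; _×_; _,_)
open import Data.Product using (proj₁; proj₂; ∃-syntax)
open import Data.Rational using (ℚ; 0ℚ; _≤_)
open import Relation.Nullary using (¬_)
open import Function.Definitions using (Injective)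
open import Relation.Binary.PropositionalEquality using (_≡_)

open import Data.Bool using (true; false; if_then_else_; _∧_; _∨_)
import Data.Bool.Properties as Boolₚ
open import Data.Empty using (⊥; ⊥-elim)
open import Data.Nat using (zero; suc; z≤n; s≤s)
import Data.Nat as ℕ
import Data.Nat.Properties as ℕₚ
open import Data.Fin using (zero; suc; toℕ)
import Data.Fin.Properties as Finₚ
open import Data.Fin.Subset using (_∈_; _∉_; _⊆_; _∪_; _∩_; _─_; ∁; ⁅_⁆; Nonempty)
  renaming (⊥ to ∅ₛ; ⊤ to Pₛ; _-_ to _∖ₛ_)
open import Data.Fin.Subset.Properties
  using (_∈?_; _⊆?_; nonempty?; Empty-unique; ∉⊥; ∈⊤; x∈⁅x⁆; x∈⁅y⁆⇒x≡y; x∈p∪q⁺; x∈p∪q⁻;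
         x∈p∩q⁺; x∈p∩q⁻; p⊆p∪q; q⊆p∪q; p─q⊆p; p∩q⊆q; ⊆-antisym; ∩-identityˡ; x∈p∧x∉q⇒x∈p─q;
         x∈p∧x≢y⇒x∈p-y; x∈∁p⇒x∉p; x∉p⇒x∈∁p)
open import Data.List using (List; []; _∷_; map; filter; length)
import Data.List
open import Data.List.Membership.Propositional using (find; lose) renaming (_∈_ to _∈ₗ_)
open import Data.List.Membership.Propositional.Properties
  using (∈-map⁺; ∈-map⁻; ∈-filter⁺; ∈-filter⁻; ∈-++⁺ˡ; ∈-++⁺ʳ; ∈-concatMap⁺; ∈-concatMap⁻;
         ∈-allFin)
import Data.List.Properties as Listₚ
open import Data.List.Relation.Unary.All using (All; []; _∷_)
import Data.List.Relation.Unary.All as All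
open import Data.List.Relation.Unary.Any using (here; there)
import Data.List.Relation.Unary.Any as Any
open import Data.List.Relation.Binary.Permutation.Propositional using (_↭_; ↭-sym)
open import Data.List.Relation.Binary.Permutation.Propositional.Properties
  using (↭-length; All-resp-↭; ∈-resp-↭; filter-↭)
open import Data.List.Relation.Unary.Linked using (Linked)
import Data.List.Relation.Unary.Linked as Linked
open import Data.List.Relation.Unary.Linked.Properties using (Linked⇒All)
open import Data.Rational using (1ℚ; ½; _+_; _*_; _-_; -_; _<_; 1/_; NonZero; NonNegative; nonNegative; positive)
open import Data.Rational.Properties
open import Data.Rational.Solver using (module +-*-Solver)
open import Data.List.Sort ≤-decTotalOrder using (sort; sort-↭; sort-↗)
open import Data.Vec using ([]; _∷_; lookup; tabulate)
import Data.Vec as Vec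
open import Data.Vec.Properties using ([]=⇒lookup; lookup⇒[]=; lookup∘tabulate; lookup-zipWith)
open import Data.Sum using (_⊎_; inj₁; inj₂)
open import Data.Unit using (tt)
open import Function using (_∘_; case_of_)
open import Relation.Binary.PropositionalEquality
  using (_≢_; refl; sym; trans; cong; cong₂; subst; subst₂; module ≡-Reasoning)
open import Relation.Nullary using (Dec; yes; no; does; ¬?; contradiction)
open import Relation.Nullary.Decidable using (_×-dec_; _⊎-dec_; from-yes; dec-true)
open +-*-Solver

0≤1 : 0ℚ ≤ 1ℚ
0≤1 = from-yes (0ℚ ≤? 1ℚ)

0≤½ : 0ℚ ≤ ½
0≤½ = from-yes (0ℚ ≤? ½)

p≤p+q : ∀ {p q} → 0ℚ ≤ q → p ≤ p + q
p≤p+q {p} {q} 0≤q = subst (_≤ p + q) (+-identityʳ p) (+-monoʳ-≤ p 0≤q)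

p-q≤p : ∀ {p q} → 0ℚ ≤ q → p - q ≤ p
p-q≤p {p} {q} 0≤q = subst (p - q ≤_) (+-identityʳ p) (+-monoʳ-≤ p (neg-antimono-≤ 0≤q))

p≤q⇒0≤q-p : ∀ {p q} → p ≤ q → 0ℚ ≤ q - p
p≤q⇒0≤q-p {p} {q} p≤q = subst (_≤ q - p) (+-inverseʳ p) (+-monoˡ-≤ (- p) p≤q)

p+q≤r⇒q≤r-p : ∀ {p q r} → p + q ≤ r → q ≤ r - p
p+q≤r⇒q≤r-p {p} {q} {r} p+q≤r =
  subst (_≤ r - p) (solve 2 (λ p q → (p :+ q) :- p := q) refl p q) (+-monoˡ-≤ (- p) p+q≤r)

q≤r-p⇒p+q≤r : ∀ {p q r} → q ≤ r - p → p + q ≤ r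
q≤r-p⇒p+q≤r {p} {q} {r} q≤r-p =
  subst (p + q ≤_) (solve 2 (λ p r → p :+ (r :- p) := r) refl p r) (+-monoʳ-≤ p q≤r-p)

0≤q-p⇒p≤q : ∀ {p q} → 0ℚ ≤ q - p → p ≤ q
0≤q-p⇒p≤q {p} {q} 0≤q-p = subst (_≤ q) (+-identityʳ p) (q≤r-p⇒p+q≤r 0≤q-p)

p≤q+r⇒p-q≤r : ∀ {p q r} → p ≤ q + r → p - q ≤ r
p≤q+r⇒p-q≤r {p} {q} {r} p≤q+r =
  subst (p - q ≤_) (solve 2 (λ q r → (q :+ r) :- q := r) refl q r) (+-monoˡ-≤ (- q) p≤q+r)

≤-+-≡⇒≡ : ∀ {p q r s} → p ≤ q → r ≤ s → p + r ≡ q + s → p ≡ q × r ≡ s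
≤-+-≡⇒≡ {p} {q} {r} {s} p≤q r≤s eq = ≤-antisym p≤q q≤p , ≤-antisym r≤s s≤r
  where
  q≤p : q ≤ p
  q≤p = subst (q ≤_) (solve 2 (λ p r → (p :+ r) :- r := p) refl p r)
          (p+q≤r⇒q≤r-p (subst (_≤ p + r) (+-comm q r) (≤-trans (+-monoʳ-≤ q r≤s) (≤-reflexive (sym eq)))))
  s≤r : s ≤ r
  s≤r = subst (s ≤_) (solve 2 (λ p r → (p :+ r) :- p := r) refl p r)
          (p+q≤r⇒q≤r-p (≤-trans (+-monoˡ-≤ s p≤q) (≤-reflexive (sym eq))))

sumFin-cong : ∀ {k} {f g : Fin k → ℚ} → (∀ i → f i ≡ g i) → sumFin f ≡ sumFin g
sumFin-cong {zero}  f≗g = refl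
sumFin-cong {suc k} f≗g = cong₂ _+_ (f≗g zero) (sumFin-cong (f≗g ∘ suc))

sumFin-mono : ∀ {k} {f g : Fin k → ℚ} → (∀ i → f i ≤ g i) → sumFin f ≤ sumFin g
sumFin-mono {zero}  f≤g = ≤-refl
sumFin-mono {suc k} f≤g = +-mono-≤ (f≤g zero) (sumFin-mono (f≤g ∘ suc))

sumFin-+ : ∀ {k} (f g : Fin k → ℚ) → sumFin (λ i → f i + g i) ≡ sumFin f + sumFin g
sumFin-+ {zero}  f g = refl
sumFin-+ {suc k} f g rewrite sumFin-+ (f ∘ suc) (g ∘ suc) =
  solve 4 (λ a b c d → (a :+ b) :+ (c :+ d) := (a :+ c) :+ (b :+ d)) refl
    (f zero) (g zero) (sumFin (f ∘ suc)) (sumFin (g ∘ suc))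

sumFin-neg : ∀ {k} (f : Fin k → ℚ) → sumFin (λ i → - f i) ≡ - sumFin f
sumFin-neg {zero}  f = refl
sumFin-neg {suc k} f rewrite sumFin-neg (f ∘ suc) = sym (neg-distrib-+ (f zero) (sumFin (f ∘ suc)))

sumFin-*ˡ : ∀ {k} (a : ℚ) (f : Fin k → ℚ) → sumFin (λ i → a * f i) ≡ a * sumFin f
sumFin-*ˡ {zero}  a f = sym (*-zeroʳ a)
sumFin-*ˡ {suc k} a f rewrite sumFin-*ˡ a (f ∘ suc) = sym (*-distribˡ-+ a (f zero) _)

sumFin-0 : ∀ {k} → sumFin {k} (λ _ → 0ℚ) ≡ 0ℚ
sumFin-0 {zero}  = refl
sumFin-0 {suc k} rewrite sumFin-0 {k} = refl

sumFin-nonNeg : ∀ {k} {f : Fin k → ℚ} → (∀ i → 0ℚ ≤ f i) → 0ℚ ≤ sumFin f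
sumFin-nonNeg {k} {f} f≥0 = subst (_≤ sumFin f) (sumFin-0 {k}) (sumFin-mono f≥0)

term≤sumFin : ∀ {k} {f : Fin k → ℚ} → (∀ i → 0ℚ ≤ f i) → ∀ j → f j ≤ sumFin f
term≤sumFin f≥0 zero    = p≤p+q (sumFin-nonNeg (f≥0 ∘ suc))
term≤sumFin {f = f} f≥0 (suc j) = ≤-trans (term≤sumFin (f≥0 ∘ suc) j)
  (subst (_≤ sumFin f) (+-identityˡ _) (+-monoˡ-≤ (sumFin (f ∘ suc)) (f≥0 zero)))

sumFin-mono-≡ : ∀ {k} {f g : Fin k → ℚ} → (∀ i → f i ≤ g i) → sumFin f ≡ sumFin g → ∀ i → f i ≡ g i
sumFin-mono-≡ {suc k} f≤g eq zero    = proj₁ (≤-+-≡⇒≡ (f≤g zero) (sumFin-mono (f≤g ∘ suc)) eq)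
sumFin-mono-≡ {suc k} f≤g eq (suc i) =
  sumFin-mono-≡ (f≤g ∘ suc) (proj₂ (≤-+-≡⇒≡ (f≤g zero) (sumFin-mono (f≤g ∘ suc)) eq)) i

∈⇒lookup : ∀ {n} {S : Subset n} {i} → i ∈ S → lookup S i ≡ true
∈⇒lookup = []=⇒lookup

lookup⇒∈ : ∀ {n} {S : Subset n} {i} → lookup S i ≡ true → i ∈ S
lookup⇒∈ = lookup⇒[]= _ _

∉⇒lookup : ∀ {n} {S : Subset n} {i} → i ∉ S → lookup S i ≡ false
∉⇒lookup {S = S} {i} i∉S with lookup S i in e
... | true  = contradiction (lookup⇒∈ e) i∉S
... | false = refl

lookup⇒∉ : ∀ {n} {S : Subset n} {i} → lookup S i ≡ false → i ∉ S
lookup⇒∉ e i∈S = case trans (sym e) (∈⇒lookup i∈S) of λ ()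

x∈p─q⇒x∉q : ∀ {n} {p q : Subset n} {x} → x ∈ p ─ q → x ∉ q
x∈p─q⇒x∉q {p = _ ∷ _} {true ∷ _}  (Vec.there x∈p─q) (Vec.there x∈q) = x∈p─q⇒x∉q x∈p─q x∈q
x∈p─q⇒x∉q {p = _ ∷ _} {false ∷ _} Vec.here          ()
x∈p─q⇒x∉q {p = _ ∷ _} {false ∷ _} (Vec.there x∈p─q) (Vec.there x∈q) = x∈p─q⇒x∉q x∈p─q x∈q

x∈p-y⇒x≢y : ∀ {n} {p : Subset n} {x y} → x ∈ p ∖ₛ y → x ≢ y
x∈p-y⇒x≢y {x = x} x∈p-y refl = x∈p─q⇒x∉q x∈p-y (x∈⁅x⁆ x)

⊆-∖ₛ : ∀ {n} {S A : Subset n} {p} → S ⊆ A → p ∉ S → S ⊆ A ∖ₛ p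
⊆-∖ₛ S⊆A p∉S i∈S = x∈p∧x≢y⇒x∈p-y (S⊆A i∈S) (λ { refl → p∉S i∈S })

Meets : ∀ {n} → Subset n → Subset n → Set
Meets A B = ∃[ i ] i ∈ A × i ∈ B

meets? : ∀ {n} (A B : Subset n) → Dec (Meets A B)
meets? A B = Finₚ.any? (λ i → (i ∈? A) ×-dec (i ∈? B))

∈-unionOf⁻ : ∀ {n m} (T : Fin m → Subset n) U {i} → i ∈ unionOf T U → ∃[ j ] j ∈ U × i ∈ T j
∈-unionOf⁻ {m = zero}  T []          i∈⋃ = contradiction i∈⋃ ∉⊥
∈-unionOf⁻ {m = suc m} T (true ∷ U)  i∈⋃ with x∈p∪q⁻ (T zero) _ i∈⋃
... | inj₁ i∈T₀ = zero , Vec.here , i∈T₀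
... | inj₂ i∈⋃′ = let j , j∈U , i∈Tj = ∈-unionOf⁻ (T ∘ suc) U i∈⋃′ in suc j , Vec.there j∈U , i∈Tj
∈-unionOf⁻ {m = suc m} T (false ∷ U) i∈⋃ with x∈p∪q⁻ ∅ₛ _ i∈⋃
... | inj₁ i∈∅ = contradiction i∈∅ ∉⊥
... | inj₂ i∈⋃′ = let j , j∈U , i∈Tj = ∈-unionOf⁻ (T ∘ suc) U i∈⋃′ in suc j , Vec.there j∈U , i∈Tj

∈-unionOf⁺ : ∀ {n m} (T : Fin m → Subset n) {U j i} → j ∈ U → i ∈ T j → i ∈ unionOf T U
∈-unionOf⁺ T Vec.here        i∈Tj = x∈p∪q⁺ (inj₁ i∈Tj)
∈-unionOf⁺ T (Vec.there j∈U) i∈Tj = x∈p∪q⁺ (inj₂ (∈-unionOf⁺ (T ∘ suc) j∈U i∈Tj))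

unionOf-mono : ∀ {n m} (T : Fin m → Subset n) {U V} → U ⊆ V → unionOf T U ⊆ unionOf T V
unionOf-mono T U⊆V i∈⋃U = let j , j∈U , i∈Tj = ∈-unionOf⁻ T _ i∈⋃U in ∈-unionOf⁺ T (U⊆V j∈U) i∈Tj

⁅⁆-covers : ∀ {n m} (T : Fin m → Subset n) {S j} → S ⊆ T j → Covers T S ⁅ j ⁆
⁅⁆-covers T {j = j} S⊆Tj i∈S = ∈-unionOf⁺ T (x∈⁅x⁆ j) (S⊆Tj i∈S)

if-nonNeg : ∀ b {a} → 0ℚ ≤ a → 0ℚ ≤ (if b then a else 0ℚ)
if-nonNeg true  0≤a = 0≤a
if-nonNeg false _   = ≤-refl

-- sumOn u S is definitionally sumFin (u ↾ S).
_↾_ : ∀ {n} → (Fin n → ℚ) → Subset n → Fin n → ℚ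
(u ↾ S) i = if lookup S i then u i else 0ℚ

sumOn-∅ : ∀ {n} (u : Fin n → ℚ) → sumOn u ∅ₛ ≡ 0ℚ
sumOn-∅ {zero}  u = refl
sumOn-∅ {suc n} u = trans (+-identityˡ _) (sumOn-∅ (u ∘ suc))

sumOn-⁅⁆ : ∀ {n} (u : Fin n → ℚ) p → sumOn u ⁅ p ⁆ ≡ u p
sumOn-⁅⁆ {suc n} u zero    = trans (cong (u zero +_) (sumOn-∅ (u ∘ suc))) (+-identityʳ (u zero))
sumOn-⁅⁆ {suc n} u (suc p) = trans (+-identityˡ _) (sumOn-⁅⁆ (u ∘ suc) p)

module _ {n : ℕ} where

  sumOn-nonNeg : ∀ {u : Fin n → ℚ} → (∀ i → 0ℚ ≤ u i) → ∀ S → 0ℚ ≤ sumOn u S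
  sumOn-nonNeg u≥0 S = sumFin-nonNeg (λ i → if-nonNeg (lookup S i) (u≥0 i))

  sumOn-mono : ∀ {u v : Fin n → ℚ} → (∀ i → u i ≤ v i) → ∀ S → sumOn u S ≤ sumOn v S
  sumOn-mono {u} {v} u≤v S = sumFin-mono pointwise
    where
    pointwise : ∀ i → (u ↾ S) i ≤ (v ↾ S) i
    pointwise i with lookup S i
    ... | true  = u≤v i
    ... | false = ≤-refl

  sumOn-mono-⊆ : ∀ {u : Fin n → ℚ} → (∀ i → 0ℚ ≤ u i) → ∀ {S A} → S ⊆ A → sumOn u S ≤ sumOn u A
  sumOn-mono-⊆ {u} u≥0 {S} {A} S⊆A = sumFin-mono pointwise
    where
    pointwise : ∀ i → (u ↾ S) i ≤ (u ↾ A) i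
    pointwise i with lookup S i in e
    ... | true rewrite ∈⇒lookup (S⊆A (lookup⇒∈ e)) = ≤-refl
    ... | false = if-nonNeg (lookup A i) (u≥0 i)

  sumOn-+ : ∀ (u v : Fin n → ℚ) S → sumOn (λ i → u i + v i) S ≡ sumOn u S + sumOn v S
  sumOn-+ u v S = trans (sumFin-cong pointwise) (sumFin-+ (u ↾ S) (v ↾ S))
    where
    pointwise : ∀ i → ((λ i → u i + v i) ↾ S) i ≡ (u ↾ S) i + (v ↾ S) i
    pointwise i with lookup S i
    ... | true  = refl
    ... | false = refl

  sumOn-vanish : ∀ {u : Fin n → ℚ} {S} → (∀ {i} → i ∈ S → u i ≡ 0ℚ) → sumOn u S ≡ 0ℚ
  sumOn-vanish {u} {S} u≡0 = trans (sumFin-cong pointwise) (sumFin-0 {n})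
    where
    pointwise : ∀ i → (u ↾ S) i ≡ 0ℚ
    pointwise i with lookup S i in e
    ... | true  = u≡0 (lookup⇒∈ e)
    ... | false = refl

  sumOn-supported : ∀ {u : Fin n → ℚ} {S} → (∀ {i} → i ∉ S → u i ≡ 0ℚ) → sumOn u S ≡ sumFin u
  sumOn-supported {u} {S} u≡0 = sumFin-cong pointwise
    where
    pointwise : ∀ i → (u ↾ S) i ≡ u i
    pointwise i with lookup S i in e
    ... | true  = refl
    ... | false = sym (u≡0 (lookup⇒∉ e))

  sumOn-Pₛ : ∀ (u : Fin n → ℚ) → sumOn u Pₛ ≡ sumFin u
  sumOn-Pₛ u = sumOn-supported (λ i∉P → contradiction ∈⊤ i∉P)

  sumOn-remove : ∀ (u : Fin n → ℚ) {A p} → p ∈ A → sumOn u (A ∖ₛ p) + u p ≡ sumOn u A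
  sumOn-remove u {A} {p} p∈A = begin
    sumOn u (A ∖ₛ p) + u p              ≡⟨ cong (sumOn u (A ∖ₛ p) +_) (sym (sumOn-⁅⁆ u p)) ⟩
    sumOn u (A ∖ₛ p) + sumOn u ⁅ p ⁆    ≡⟨ sym (sumFin-+ (u ↾ (A ∖ₛ p)) (u ↾ ⁅ p ⁆)) ⟩
    sumFin (λ i → (u ↾ (A ∖ₛ p)) i + (u ↾ ⁅ p ⁆) i) ≡⟨ sumFin-cong pointwise ⟩
    sumOn u A                            ∎
    where
    open ≡-Reasoning
    pointwise : ∀ i → (u ↾ (A ∖ₛ p)) i + (u ↾ ⁅ p ⁆) i ≡ (u ↾ A) i
    pointwise i with i Finₚ.≟ p
    ... | yes refl rewrite ∉⇒lookup {S = A ∖ₛ i} (λ i∈A-i → x∈p-y⇒x≢y {p = A} i∈A-i refl)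
                         | ∈⇒lookup (x∈⁅x⁆ i) | ∈⇒lookup p∈A = +-identityˡ (u i)
    ... | no i≢p with i ∈? A
    ...   | yes i∈A rewrite ∈⇒lookup (x∈p∧x≢y⇒x∈p-y {p = A} i∈A i≢p)
                          | ∉⇒lookup (i≢p ∘ x∈⁅y⁆⇒x≡y p) | ∈⇒lookup i∈A = +-identityʳ (u i)
    ...   | no i∉A  rewrite ∉⇒lookup {S = A ∖ₛ p} (i∉A ∘ p─q⊆p A ⁅ p ⁆)
                          | ∉⇒lookup (i≢p ∘ x∈⁅y⁆⇒x≡y p) | ∉⇒lookup i∉A = +-identityˡ 0ℚ

-- Excesses as cheapest covers

minList-≤ : ∀ {v} xs → v ∈ₗ xs → minList xs ≤ v
minList-≤ (x ∷ [])     (here refl)              = ≤-refl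
minList-≤ (x ∷ y ∷ ys) (here refl)              = p≤q⇒r⊓p≤q y (minList-≤ (x ∷ ys) (here refl))
minList-≤ (x ∷ y ∷ ys) (there (here refl))      = p⊓q≤p y _
minList-≤ (x ∷ y ∷ ys) (there (there v∈ys))     = p≤q⇒r⊓p≤q y (minList-≤ (x ∷ ys) (there v∈ys))

minList-glb : ∀ {v u} xs → u ∈ₗ xs → (∀ {a} → a ∈ₗ xs → v ≤ a) → v ≤ minList xs
minList-glb (x ∷ [])     _ v≤xs = v≤xs (here refl)
minList-glb (x ∷ y ∷ ys) _ v≤xs =
  ⊓-glb (v≤xs (there (here refl)))
        (minList-glb (x ∷ ys) (here refl) λ where
          (here refl)  → v≤xs (here refl)
          (there a∈ys) → v≤xs (there (there a∈ys)))

∈-allSubsets : ∀ {k} (S : Subset k) → S ∈ₗ allSubsets k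
∈-allSubsets []                = here refl
∈-allSubsets {suc k} (false ∷ S) = ∈-++⁺ˡ (∈-map⁺ (false ∷_) (∈-allSubsets S))
∈-allSubsets {suc k} (true ∷ S)  = ∈-++⁺ʳ (map (false ∷_) (allSubsets k)) (∈-map⁺ (true ∷_) (∈-allSubsets S))

isNonempty-∈ : ∀ {k} {S : Subset k} {i} → i ∈ S → isNonempty S ≡ true
isNonempty-∈ {S = true ∷ S}  _               = refl
isNonempty-∈ {S = false ∷ S} (Vec.there i∈S) = isNonempty-∈ i∈S

∈-coalitions : ∀ {k} {S : Subset k} {i} → i ∈ S → S ∈ₗ coalitions k
∈-coalitions {S = S} i∈S = ∈-filter⁺ (λ S → isNonempty S Boolₚ.≟ true) (∈-allSubsets S) (isNonempty-∈ i∈S)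

excess-≡ : ∀ {n m} (T : Fin m → Subset n) c y {S U₀ v} → Covers T S U₀ → costOf c U₀ ≤ v →
           (∀ U → Covers T S U → v ≤ costOf c U) → excess T c y S ≡ v - sumOn y S
excess-≡ {m = m} T c y {S} {U₀} {v} U₀-covers U₀-cost cheapest =
  ≤-antisym (≤-trans (minList-≤ excesses U₀∈) (+-monoˡ-≤ (- sumOn y S) U₀-cost))
            (minList-glb excesses U₀∈ bound)
  where
  covers? : ∀ U → Dec (S ⊆ unionOf T U)
  covers? U = S ⊆? unionOf T U
  excesses : List ℚ
  excesses = map (λ U → excessPair c y (S , U)) (filter covers? (allSubsets m))
  U₀∈ : excessPair c y (S , U₀) ∈ₗ excesses
  U₀∈ = ∈-map⁺ _ (∈-filter⁺ covers? (∈-allSubsets U₀) U₀-covers)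
  bound : ∀ {a} → a ∈ₗ excesses → v - sumOn y S ≤ a
  bound a∈ with ∈-map⁻ _ a∈
  ... | U , U∈ , refl = +-monoˡ-≤ (- sumOn y S) (cheapest U (proj₂ (∈-filter⁻ covers? {xs = allSubsets m} U∈)))

-- Lexicographic order on sorted lists

_<lex_ : List ℚ → List ℚ → Set
[]       <lex _        = ⊥
(x ∷ xs) <lex []       = ⊥
(x ∷ xs) <lex (y ∷ ys) = x < y ⊎ (x ≡ y × xs <lex ys)

<lex⇒≱lex : ∀ {xs ys} → xs <lex ys → ¬ ys ≤lex xs
<lex⇒≱lex {x ∷ xs} {y ∷ ys} (inj₁ x<y)        (inj₁ y<x)        = <-asym x<y y<x
<lex⇒≱lex {x ∷ xs} {y ∷ ys} (inj₁ x<y)        (inj₂ (refl , _)) = <-irrefl refl x<y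
<lex⇒≱lex {x ∷ xs} {y ∷ ys} (inj₂ (refl , _)) (inj₁ y<x)        = <-irrefl refl y<x
<lex⇒≱lex {x ∷ xs} {y ∷ ys} (inj₂ (_ , xs<ys)) (inj₂ (_ , ys≤xs)) = <lex⇒≱lex xs<ys ys≤xs

<lex⇒≤lex : ∀ {xs ys} → xs <lex ys → xs ≤lex ys
<lex⇒≤lex {x ∷ xs} {y ∷ ys} (inj₁ x<y)          = inj₁ x<y
<lex⇒≤lex {x ∷ xs} {y ∷ ys} (inj₂ (x≡y , xs<ys)) = inj₂ (x≡y , <lex⇒≤lex xs<ys)

≤lex-refl : ∀ xs → xs ≤lex xs
≤lex-refl []       = tt
≤lex-refl (x ∷ xs) = inj₂ (refl , ≤lex-refl xs)

count : ∀ {P : ℚ → Set} → (∀ x → Dec (P x)) → List ℚ → ℕ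
count P? = length ∘ filter P?

module _ {P : ℚ → Set} (P? : ∀ x → Dec (P x)) where

  count-accept : ∀ {x} xs → P x → count P? (x ∷ xs) ≡ suc (count P? xs)
  count-accept xs Px = cong length (Listₚ.filter-accept P? Px)

  count-↭ : ∀ {xs ys} → xs ↭ ys → count P? xs ≡ count P? ys
  count-↭ xs↭ys = ↭-length (filter-↭ P? xs↭ys)

  count-pos⇒∃ : ∀ xs → 0 ℕ.< count P? xs → ∃[ v ] v ∈ₗ xs × P v
  count-pos⇒∃ xs pos with filter P? xs in eq
  ... | v ∷ _ = v , ∈-filter⁻ P? (subst (v ∈ₗ_) (sym eq) (here refl))

  module _ {Q : ℚ → Set} (Q? : ∀ x → Dec (Q x)) {A : Set} (f g : A → ℚ) where

    count-map-≤ : ∀ L → (∀ {a} → a ∈ₗ L → P (g a) → Q (f a)) → count P? (map g L) ℕ.≤ count Q? (map f L)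
    count-map-≤ []      _   = z≤n
    count-map-≤ (a ∷ L) P⇒Q with P? (g a) | Q? (f a)
    ... | yes Pga | yes _   = s≤s (count-map-≤ L (P⇒Q ∘ there))
    ... | yes Pga | no ¬Qfa = contradiction (P⇒Q (here refl) Pga) ¬Qfa
    ... | no _    | yes _   = ℕₚ.m≤n⇒m≤1+n (count-map-≤ L (P⇒Q ∘ there))
    ... | no _    | no _    = count-map-≤ L (P⇒Q ∘ there)

    count-map-< : ∀ L → (∀ {a} → a ∈ₗ L → P (g a) → Q (f a)) →
                  ∀ {a₀} → a₀ ∈ₗ L → ¬ P (g a₀) → Q (f a₀) → count P? (map g L) ℕ.< count Q? (map f L)
    count-map-< (a ∷ L) P⇒Q (here refl) ¬Pga Qfa
      rewrite Listₚ.filter-reject P? {xs = map g L} ¬Pga | Listₚ.filter-accept Q? {xs = map f L} Qfa =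
      s≤s (count-map-≤ L (P⇒Q ∘ there))
    count-map-< (a ∷ L) P⇒Q (there a₀∈L) ¬Pga₀ Qfa₀ with P? (g a) | Q? (f a)
    ... | yes Pga | yes _   = s≤s (count-map-< L (P⇒Q ∘ there) a₀∈L ¬Pga₀ Qfa₀)
    ... | yes Pga | no ¬Qfa = contradiction (P⇒Q (here refl) Pga) ¬Qfa
    ... | no _    | yes _   = ℕₚ.m≤n⇒m≤1+n (count-map-< L (P⇒Q ∘ there) a₀∈L ¬Pga₀ Qfa₀)
    ... | no _    | no _    = count-map-< L (P⇒Q ∘ there) a₀∈L ¬Pga₀ Qfa₀

head≤ : ∀ {x v xs} → Linked _≤_ (x ∷ xs) → v ∈ₗ x ∷ xs → x ≤ v
head≤ sorted v∈ = All.lookup (Linked⇒All ≤-trans ≤-refl sorted) v∈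

-- The first count (_<? w) ys entries of xs are 0: either ys is positive within this block,
-- or it is 0 there too and at the next position xs is below w while ys is not.
sorted-<lex : ∀ w (xs ys : List ℚ) → Linked _≤_ xs → Linked _≤_ ys → length xs ≡ length ys →
              All (0ℚ ≤_) xs → All (0ℚ ≤_) ys →
              count (_<? w) ys ℕ.≤ count (_≟ 0ℚ) xs → count (_<? w) ys ℕ.< count (_<? w) xs →
              xs <lex ys
sorted-<lex w (x ∷ xs) (y ∷ ys) ↗xs ↗ys len (0≤x ∷ 0≤xs) (0≤y ∷ 0≤ys) few more with y <? w
... | no y≮w =
  let v , v∈ , v<w = count-pos⇒∃ (_<? w) (x ∷ xs) (ℕₚ.≤-<-trans z≤n more)
  in inj₁ (≤-<-trans (head≤ ↗xs v∈) (<-≤-trans v<w (≮⇒≥ y≮w)))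
... | yes y<w = case 0ℚ <? y of λ where
    (yes 0<y) → inj₁ (subst (_< y) (sym x≡0) 0<y)
    (no 0≮y)  → let x≡y = trans x≡0 (sym (≤-antisym (≮⇒≥ 0≮y) 0≤y)) in
      inj₂ (x≡y , sorted-<lex w xs ys (Linked.tail ↗xs) (Linked.tail ↗ys) (ℕₚ.suc-injective len) 0≤xs 0≤ys
                    (ℕₚ.≤-pred (subst₂ ℕ._≤_ (count-accept (_<? w) ys y<w) (count-accept (_≟ 0ℚ) xs x≡0) few))
                    (ℕₚ.≤-pred (subst₂ ℕ._<_ (count-accept (_<? w) ys y<w)
                                             (count-accept (_<? w) xs (subst (_< w) (sym x≡y) y<w)) more)))
  where
  x≡0 : x ≡ 0ℚ
  x≡0 = let v , v∈ , v≡0 = count-pos⇒∃ (_≟ 0ℚ) (x ∷ xs)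
                             (ℕₚ.<-≤-trans (s≤s z≤n) (subst (ℕ._≤ _) (count-accept (_<? w) ys y<w) few))
        in ≤-antisym (subst (x ≤_) v≡0 (head≤ ↗xs v∈)) 0≤x

module _ {A : Set} (L : List A) (f g : A → ℚ) where

  private
    length-sort : length (sort (map f L)) ≡ length (sort (map g L))
    length-sort = begin
      length (sort (map f L)) ≡⟨ ↭-length (sort-↭ (map f L)) ⟩
      length (map f L)        ≡⟨ Listₚ.length-map f L ⟩
      length L                ≡⟨ sym (Listₚ.length-map g L) ⟩
      length (map g L)        ≡⟨ sym (↭-length (sort-↭ (map g L))) ⟩
      length (sort (map g L)) ∎
      where open ≡-Reasoning

    All-sort : ∀ {P : ℚ → Set} (h : A → ℚ) → (∀ {a} → a ∈ₗ L → P (h a)) → All P (sort (map h L))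
    All-sort {P} h P∘h = All-resp-↭ (↭-sym (sort-↭ (map h L)))
                           (All.tabulate λ v∈ → case ∈-map⁻ h v∈ of λ { (a , a∈L , refl) → P∘h a∈L })

    count-sort : ∀ {P : ℚ → Set} (P? : ∀ x → Dec (P x)) (h : A → ℚ) →
                 count P? (sort (map h L)) ≡ count P? (map h L)
    count-sort P? h = count-↭ P? (sort-↭ (map h L))

  sort-<lex-negative : ∀ {a} → a ∈ₗ L → f a < 0ℚ → (∀ {a} → a ∈ₗ L → 0ℚ ≤ g a) →
                       sort (map f L) <lex sort (map g L)
  sort-<lex-negative {a} a∈L fa<0 g≥0 =
    go (sort (map f L)) (sort (map g L)) (sort-↗ (map f L)) length-sort
       (∈-resp-↭ (↭-sym (sort-↭ (map f L))) (∈-map⁺ f a∈L)) (All-sort g g≥0)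
    where
    go : ∀ xs ys → Linked _≤_ xs → length xs ≡ length ys → f a ∈ₗ xs → All (0ℚ ≤_) ys → xs <lex ys
    go (x ∷ xs) (y ∷ ys) ↗xs _ fa∈ (0≤y ∷ _) = inj₁ (≤-<-trans (head≤ ↗xs fa∈) (<-≤-trans fa<0 0≤y))

  sort-<lex-threshold : ∀ {w} → (∀ {a} → a ∈ₗ L → 0ℚ ≤ f a) →
                        (∀ {a} → a ∈ₗ L → w ≤ g a ⊎ (f a ≡ 0ℚ × 0ℚ ≤ g a)) →
                        ∀ {a₀} → a₀ ∈ₗ L → f a₀ < w → w ≤ g a₀ →
                        sort (map f L) <lex sort (map g L)
  sort-<lex-threshold {w} f≥0 dichotomy {a₀} a₀∈L fa₀<w w≤ga₀ =
    sorted-<lex w (sort (map f L)) (sort (map g L)) (sort-↗ (map f L)) (sort-↗ (map g L)) length-sort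
      (All-sort f f≥0) (All-sort g g≥0)
      (subst₂ ℕ._≤_ (sym (count-sort (_<? w) g)) (sym (count-sort (_≟ 0ℚ) f))
        (count-map-≤ (_<? w) (_≟ 0ℚ) f g L below⇒f≡0))
      (subst₂ ℕ._<_ (sym (count-sort (_<? w) g)) (sym (count-sort (_<? w) f))
        (count-map-< (_<? w) (_<? w) f g L (λ a∈L ga<w → subst (_< w) (sym (below⇒f≡0 a∈L ga<w)) 0<w)
                     a₀∈L (λ ga₀<w → <-irrefl refl (<-≤-trans ga₀<w w≤ga₀)) fa₀<w))
    where
    0<w : 0ℚ < w
    0<w = ≤-<-trans (f≥0 a₀∈L) fa₀<w
    g≥0 : ∀ {a} → a ∈ₗ L → 0ℚ ≤ g a
    g≥0 a∈L with dichotomy a∈L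
    ... | inj₁ w≤ga        = ≤-trans (<⇒≤ 0<w) w≤ga
    ... | inj₂ (_ , 0≤ga)  = 0≤ga
    below⇒f≡0 : ∀ {a} → a ∈ₗ L → g a < w → f a ≡ 0ℚ
    below⇒f≡0 a∈L ga<w with dichotomy a∈L
    ... | inj₁ w≤ga       = contradiction (<-≤-trans ga<w w≤ga) (<-irrefl refl)
    ... | inj₂ (fa≡0 , _) = fa≡0

<lex⇒¬Determines : ∀ {n m} {T : Fin m → Subset n} {c C y z} → IsHappyNucleolus T c y → Admissible T c z →
              excessVectorOn C c y <lex excessVectorOn C c z → ¬ Determines T c C
<lex⇒¬Determines nucleolus z-admissible y<z determines =
  <lex⇒≱lex y<z (proj₂ (proj₁ (determines _ nucleolus)) _ z-admissible)

module _ {n m : ℕ} (T : Fin m → Subset n) (x : Subset n × Subset m) where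

  private
    Simple : Fin m → Subset n → Set
    Simple j S = (isNonempty S ≡ true) × (S ⊆ T j)

    simple? : ∀ j S → Dec (Simple j S)
    simple? j S = (isNonempty S Boolₚ.≟ true) ×-dec (S ⊆? T j)

    pairsOf : Fin m → List (Subset n × Subset m)
    pairsOf j = map (_, ⁅ j ⁆) (filter (simple? j) (allSubsets n))

  ∈-removePair-simpleFamily⁻ : ∀ {a} → a ∈ₗ removePair (simpleFamily T) x →
                               ∃[ j ] ∃[ S ] a ≡ (S , ⁅ j ⁆) × S ⊆ T j × a ≢ x
  ∈-removePair-simpleFamily⁻ a∈ =
    let a∈simple , a≢x = ∈-filter⁻ (λ a → ¬? (pairEq? a x)) {xs = simpleFamily T} a∈
        j , a∈pairs    = Any.satisfied (∈-concatMap⁻ pairsOf {xs = Data.List.allFin m} a∈simple)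
        S , S∈ , a≡    = ∈-map⁻ (_, ⁅ j ⁆) a∈pairs
    in j , S , a≡ , proj₂ (proj₂ (∈-filter⁻ (simple? j) {xs = allSubsets n} S∈)) , a≢x

  ∈-removePair-simpleFamily⁺ : ∀ {j S i} → i ∈ S → S ⊆ T j → (S , ⁅ j ⁆) ≢ x →
                               (S , ⁅ j ⁆) ∈ₗ removePair (simpleFamily T) x
  ∈-removePair-simpleFamily⁺ {j} {S} i∈S S⊆Tj pair≢x =
    let S∈simple = ∈-filter⁺ (simple? j) (∈-allSubsets S) (isNonempty-∈ i∈S , S⊆Tj) in
    ∈-filter⁺ (λ a → ¬? (pairEq? a x))
      (∈-concatMap⁺ pairsOf {xs = Data.List.allFin m}
        (Any.map (λ { refl → ∈-map⁺ (_, ⁅ j ⁆) S∈simple }) (∈-allFin j)))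
      pair≢x

𝟙 : ∀ {n} → Subset n → Fin n → ℚ
𝟙 S = (λ _ → 1ℚ) ↾ S

size : ∀ {n} → Subset n → ℚ
size S = sumFin (𝟙 S)

ifYes : ∀ {P : Set} → Dec P → ℚ → ℚ
ifYes (yes _) a = a
ifYes (no _)  _ = 0ℚ

ifYes-nonNeg : ∀ {P : Set} (d : Dec P) {a} → 0ℚ ≤ a → 0ℚ ≤ ifYes d a
ifYes-nonNeg (yes _) 0≤a = 0≤a
ifYes-nonNeg (no _)  _   = ≤-refl

ifYes-≤ : ∀ {P : Set} (d : Dec P) {a} → 0ℚ ≤ a → ifYes d a ≤ a
ifYes-≤ (yes _) _   = ≤-refl
ifYes-≤ (no _)  0≤a = 0≤a

ifYes-yes : ∀ {P : Set} (d : Dec P) {a} → P → ifYes d a ≡ a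
ifYes-yes (yes _) _  = refl
ifYes-yes (no ¬p) p  = contradiction p ¬p

ifYes-no : ∀ {P : Set} (d : Dec P) {a} → ¬ P → ifYes d a ≡ 0ℚ
ifYes-no (yes p) ¬p = contradiction p ¬p
ifYes-no (no _)  _  = refl

module _ {n : ℕ} where

  size-nonNeg : ∀ (S : Subset n) → 0ℚ ≤ size S
  size-nonNeg = sumOn-nonNeg (λ _ → 0≤1)

  sumOn-cong : ∀ {u v : Fin n → ℚ} {S} → (∀ {i} → i ∈ S → u i ≡ v i) → sumOn u S ≡ sumOn v S
  sumOn-cong {u} {v} {S} u≡v = sumFin-cong pointwise
    where
    pointwise : ∀ i → (u ↾ S) i ≡ (v ↾ S) i
    pointwise i with lookup S i in e
    ... | true  = u≡v (lookup⇒∈ e)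
    ... | false = refl

  term≤sumOn : ∀ {u : Fin n → ℚ} → (∀ i → 0ℚ ≤ u i) → ∀ {S i} → i ∈ S → u i ≤ sumOn u S
  term≤sumOn {u} u≥0 {S} {i} i∈S =
    subst (_≤ sumOn u S) (cong (λ b → if b then u i else 0ℚ) (∈⇒lookup i∈S))
      (term≤sumFin (λ j → if-nonNeg (lookup S j) (u≥0 j)) i)

  sumOn-∩≤ : ∀ {u : Fin n → ℚ} → (∀ i → 0ℚ ≤ u i) → ∀ S A →
             sumOn u (S ∩ A) ≤ ifYes (meets? S A) (sumOn u A)
  sumOn-∩≤ u≥0 S A with meets? S A
  ... | yes _     = sumOn-mono-⊆ u≥0 (p∩q⊆q S A)
  ... | no ¬meets = ≤-reflexive (sumOn-vanish (λ i∈S∩A → contradiction (_ , x∈p∩q⁻ S A i∈S∩A) ¬meets))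

  sumOn-∩-full : ∀ (u : Fin n → ℚ) S A → (Meets S A → A ⊆ S) →
                 sumOn u (S ∩ A) ≡ ifYes (meets? S A) (sumOn u A)
  sumOn-∩-full u S A A⊆S with meets? S A
  ... | yes meets = cong (sumOn u) (⊆-antisym (p∩q⊆q S A) (λ i∈A → x∈p∩q⁺ (A⊆S meets i∈A , i∈A)))
  ... | no ¬meets = sumOn-vanish (λ i∈S∩A → contradiction (_ , x∈p∩q⁻ S A i∈S∩A) ¬meets)

  sumOn-∖ₛ : ∀ (u : Fin n → ℚ) {A p} → p ∈ A → sumOn u A - sumOn u (A ∖ₛ p) ≡ u p
  sumOn-∖ₛ u {A} {p} p∈A = trans (cong (_- sumOn u (A ∖ₛ p)) (sym (sumOn-remove u p∈A)))
    (solve 2 (λ a b → a :+ b :- a := b) refl (sumOn u (A ∖ₛ p)) (u p))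

  sumOn-⊆-miss : ∀ {u : Fin n → ℚ} → (∀ i → 0ℚ ≤ u i) → ∀ {S A p} → S ⊆ A → p ∈ A → p ∉ S →
                 sumOn u S + u p ≤ sumOn u A
  sumOn-⊆-miss {u} u≥0 {S} {A} {p} S⊆A p∈A p∉S =
    ≤-trans (+-monoˡ-≤ (u p) (sumOn-mono-⊆ u≥0 (⊆-∖ₛ S⊆A p∉S))) (≤-reflexive (sumOn-remove u p∈A))

  sumOn-∩-miss : ∀ {u : Fin n → ℚ} → (∀ i → 0ℚ ≤ u i) → ∀ S {A p} → p ∈ A → p ∉ S →
                 sumOn u (S ∩ A) + u p ≤ sumOn u A
  sumOn-∩-miss u≥0 S {A} p∈A p∉S = sumOn-⊆-miss u≥0 (p∩q⊆q S A) p∈A (p∉S ∘ proj₁ ∘ x∈p∩q⁻ S A)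

  sumOn≤sumFin : ∀ {u : Fin n → ℚ} → (∀ i → 0ℚ ≤ u i) → ∀ S → sumOn u S ≤ sumFin u
  sumOn≤sumFin {u} u≥0 S = ≤-trans (sumOn-mono-⊆ u≥0 {S} (λ _ → ∈⊤)) (≤-reflexive (sumOn-Pₛ u))

  sumOn-neg : ∀ (u : Fin n → ℚ) S → sumOn (λ i → - u i) S ≡ - sumOn u S
  sumOn-neg u S = trans (sumFin-cong pointwise) (sumFin-neg (u ↾ S))
    where
    pointwise : ∀ i → ((λ i → - u i) ↾ S) i ≡ - (u ↾ S) i
    pointwise i with lookup S i
    ... | true  = refl
    ... | false = refl

  sumOn-point : ∀ (a : ℚ) (p : Fin n) (S : Subset n) → sumOn (λ i → ifYes (i Finₚ.≟ p) a) S ≡ ifYes (p ∈? S) a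
  sumOn-point a p S = trans (sumFin-cong pointwise) (sumOn-⁅⁆ (λ _ → ifYes (p ∈? S) a) p)
    where
    pointwise : ∀ i → ((λ i → ifYes (i Finₚ.≟ p) a) ↾ S) i ≡ ((λ _ → ifYes (p ∈? S) a) ↾ ⁅ p ⁆) i
    pointwise i with i Finₚ.≟ p
    ... | yes refl rewrite ∈⇒lookup (x∈⁅x⁆ i) with i ∈? S
    ...   | yes i∈S rewrite ∈⇒lookup i∈S = refl
    ...   | no i∉S  rewrite ∉⇒lookup i∉S = refl
    pointwise i | no i≢p rewrite ∉⇒lookup (i≢p ∘ x∈⁅y⁆⇒x≡y p) with lookup S i
    ...   | true  = refl
    ...   | false = refl

costOf-∪ : ∀ {m} {c : Fin m → ℚ} → (∀ j → 0ℚ ≤ c j) → ∀ U V →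
           costOf c (U ∪ V) ≤ costOf c U + costOf c V
costOf-∪ {c = c} c≥0 U V = ≤-trans (sumFin-mono pointwise) (≤-reflexive (sumFin-+ (c ↾ U) (c ↾ V)))
  where
  pointwise : ∀ j → (c ↾ (U ∪ V)) j ≤ (c ↾ U) j + (c ↾ V) j
  pointwise j rewrite lookup-zipWith _∨_ j U V with lookup U j | lookup V j
  ... | true  | true  = p≤p+q (c≥0 j)
  ... | true  | false = ≤-reflexive (sym (+-identityʳ (c j)))
  ... | false | true  = ≤-reflexive (sym (+-identityˡ (c j)))
  ... | false | false = ≤-refl

module _ {n m : ℕ} (T : Fin m → Subset n) where

  ifYes-meets≤cover : ∀ A {a} → 0ℚ ≤ a → ∀ {S U} → Covers T S U →
                      ifYes (meets? S A) a ≤ sumOn (λ j → ifYes (meets? (T j) A) a) U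
  ifYes-meets≤cover A {a} 0≤a {S} {U} U-covers with meets? S A
  ... | no _ = sumOn-nonNeg (λ j → ifYes-nonNeg (meets? (T j) A) 0≤a) U
  ... | yes (i , i∈S , i∈A) =
    let j , j∈U , i∈Tj = ∈-unionOf⁻ T U (U-covers i∈S) in
    subst (_≤ _) (ifYes-yes (meets? (T j) A) (i , i∈Tj , i∈A))
      (term≤sumOn (λ j → ifYes-nonNeg (meets? (T j) A) 0≤a) j∈U)

  size≤lp : ∀ A {x} → LPFeasible T x → size A ≤ sumFin (λ j → ifYes (meets? (T j) A) (size A) * x j)
  size≤lp A {x} (x≥0 , x-covers) with nonempty? A
  ... | no empty = ≤-trans (≤-reflexive (sumOn-vanish {u = λ _ → 1ℚ} (λ i∈A → contradiction (_ , i∈A) empty)))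
                     (sumFin-nonNeg (λ j → *-nonNeg (ifYes-nonNeg (meets? (T j) A) (size-nonNeg A)) (x≥0 j)))
    where
    *-nonNeg : ∀ {p q} → 0ℚ ≤ p → 0ℚ ≤ q → 0ℚ ≤ p * q
    *-nonNeg {p} {q} 0≤p 0≤q = subst (_≤ p * q) (*-zeroˡ q) (*-monoʳ-≤-nonNeg q {{nonNegative 0≤q}} 0≤p)
  ... | yes (p , p∈A) = begin
    size A                                              ≡⟨ sym (*-identityʳ (size A)) ⟩
    size A * 1ℚ                                         ≤⟨ *-monoˡ-≤-nonNeg (size A) {{size≥0}} (x-covers p) ⟩
    size A * sumFin x∋p                                 ≡⟨ sym (sumFin-*ˡ (size A) x∋p) ⟩
    sumFin (λ j → size A * x∋p j)                       ≤⟨ sumFin-mono pointwise ⟩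
    sumFin (λ j → ifYes (meets? (T j) A) (size A) * x j) ∎
    where
    open ≤-Reasoning
    size≥0 : NonNegative (size A)
    size≥0 = nonNegative (size-nonNeg A)
    x∋p : Fin m → ℚ
    x∋p j = if lookup (T j) p then x j else 0ℚ
    pointwise : ∀ j → size A * x∋p j ≤ ifYes (meets? (T j) A) (size A) * x j
    pointwise j with lookup (T j) p in e
    ... | true  = ≤-reflexive (cong (_* x j) (sym (ifYes-yes (meets? (T j) A) (p , lookup⇒∈ e , p∈A))))
    ... | false = subst (_≤ ifYes (meets? (T j) A) (size A) * x j) (trans (*-zeroˡ (x j)) (sym (*-zeroʳ (size A))))
                    (*-monoʳ-≤-nonNeg (x j) {{nonNegative (x≥0 j)}}
                                      (ifYes-nonNeg (meets? (T j) A) (size-nonNeg A)))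

  indicator-feasible : ∀ {U} → (∀ p → p ∈ unionOf T U) → LPFeasible T (𝟙 U)
  indicator-feasible {U} U-covers = (λ j → if-nonNeg (lookup U j) 0≤1) , λ p →
    let j , j∈U , p∈Tj = ∈-unionOf⁻ T U (U-covers p) in
    subst (_≤ _) (trans (cong (λ b → if b then 𝟙 U j else 0ℚ) (∈⇒lookup p∈Tj))
                        (cong (λ b → if b then 1ℚ else 0ℚ) (∈⇒lookup j∈U)))
      (term≤sumFin (λ j → if-nonNeg (lookup (T j) p) (if-nonNeg (lookup U j) 0≤1)) j)

  indicator-cost : ∀ (c : Fin m → ℚ) U → sumFin (λ j → c j * 𝟙 U j) ≡ costOf c U
  indicator-cost c U = sumFin-cong pointwise
    where
    pointwise : ∀ j → c j * 𝟙 U j ≡ (c ↾ U) j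
    pointwise j with lookup U j
    ... | true  = *-identityʳ (c j)
    ... | false = *-zeroʳ (c j)

slack : ∀ {n} → Subset n → Subset n → ℚ
slack A S = ifYes (meets? S A) (size A) - size (S ∩ A)

module _ {n : ℕ} where

  slack-nonNeg : ∀ (A S : Subset n) → 0ℚ ≤ slack A S
  slack-nonNeg A S = p≤q⇒0≤q-p (sumOn-∩≤ (λ _ → 0≤1) S A)

  slack≥1 : ∀ {A S : Subset n} {p} → p ∈ A → p ∉ S → Meets S A → 1ℚ ≤ slack A S
  slack≥1 {A} {S} p∈A p∉S meets =
    p+q≤r⇒q≤r-p (subst (size (S ∩ A) + 1ℚ ≤_) (sym (ifYes-yes (meets? S A) meets))
                  (sumOn-∩-miss (λ _ → 0≤1) S p∈A p∉S))

  slack<1⇒⊆ : ∀ {A S : Subset n} → slack A S < 1ℚ → Meets S A → A ⊆ S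
  slack<1⇒⊆ {A} {S} slack<1 meets {i} i∈A with i ∈? S
  ... | yes i∈S = i∈S
  ... | no i∉S  = contradiction (<-≤-trans slack<1 (slack≥1 i∈A i∉S meets)) (<-irrefl refl)

-- A critical member of a cover

firstStep : ∀ {P : ℕ → Set} → (∀ t → Dec (P t)) → ¬ P 0 → ∀ {t} → P t → ∃[ s ] ¬ P s × P (suc s)
firstStep P? ¬P₀ {zero}  P₀ = contradiction P₀ ¬P₀
firstStep P? ¬P₀ {suc t} Pt+1 with P? t
... | yes Pt = firstStep P? ¬P₀ Pt
... | no ¬Pt = t , ¬Pt , Pt+1

subsetOf : ∀ {n} {P : Fin n → Set} → (∀ i → Dec (P i)) → Subset n
subsetOf P? = tabulate (does ∘ P?)

∈-subsetOf⁻ : ∀ {n} {P : Fin n → Set} (P? : ∀ i → Dec (P i)) {i} → i ∈ subsetOf P? → P i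
∈-subsetOf⁻ P? {i} i∈ with P? i | trans (sym (lookup∘tabulate (does ∘ P?) i)) (∈⇒lookup i∈)
... | yes Pi | _  = Pi
... | no _   | ()

∈-subsetOf⁺ : ∀ {n} {P : Fin n → Set} (P? : ∀ i → Dec (P i)) {i} → P i → i ∈ subsetOf P?
∈-subsetOf⁺ P? {i} Pi = lookup⇒∈ (trans (lookup∘tabulate (does ∘ P?) i) (dec-true (P? i) Pi))

record CriticalMember {n m : ℕ} (T : Fin m → Subset n) (R : Subset n) (Uc : Subset m) : Set where
  field
    UA       : Subset m
    D        : Fin m
    UA⊆Uc    : UA ⊆ Uc
    D∈Uc     : D ∈ Uc
    missed   : Nonempty (R ─ unionOf T UA)
    missed⊆D : R ─ unionOf T UA ⊆ T D

module _ {n m : ℕ} (T : Fin m → Subset n) {R : Subset n} {Uc : Subset m} where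

  private
    prefix : ℕ → Subset m
    prefix t = subsetOf (λ j → (j ∈? Uc) ×-dec (toℕ j ℕ.<? t))

    ∈-prefix⁻ : ∀ t {j} → j ∈ prefix t → j ∈ Uc × toℕ j ℕ.< t
    ∈-prefix⁻ t = ∈-subsetOf⁻ (λ j → (j ∈? Uc) ×-dec (toℕ j ℕ.<? t))

    ∈-prefix⁺ : ∀ t {j} → j ∈ Uc → toℕ j ℕ.< t → j ∈ prefix t
    ∈-prefix⁺ t j∈Uc j<t = ∈-subsetOf⁺ (λ j → (j ∈? Uc) ×-dec (toℕ j ℕ.<? t)) (j∈Uc , j<t)

    module Critical (s : ℕ) (¬covers : ¬ R ⊆ unionOf T (prefix s))
                    (covers : R ⊆ unionOf T (prefix (suc s))) where

      Missed : Subset n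
      Missed = R ─ unionOf T (prefix s)

      missed : ∃[ r ] r ∈ Missed
      missed with Finₚ.any? (λ i → (i ∈? R) ×-dec ¬? (i ∈? unionOf T (prefix s)))
      ... | yes (r , r∈R , r∉⋃) = r , x∈p∧x∉q⇒x∈p─q r∈R r∉⋃
      ... | no none = ⊥-elim (¬covers R⊆⋃)
        where
        R⊆⋃ : R ⊆ unionOf T (prefix s)
        R⊆⋃ {i} i∈R with i ∈? unionOf T (prefix s)
        ... | yes i∈⋃ = i∈⋃
        ... | no i∉⋃  = contradiction (i , i∈R , i∉⋃) none

      coveredBy : ∀ {i} → i ∈ Missed → ∃[ j ] j ∈ prefix (suc s) × i ∈ T j
      coveredBy i∈ = ∈-unionOf⁻ T (prefix (suc s)) (covers (p─q⊆p R _ i∈))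

      index≡s : ∀ {i} (i∈ : i ∈ Missed) → toℕ (proj₁ (coveredBy i∈)) ≡ s
      index≡s i∈ with coveredBy i∈
      ... | j , j∈ , i∈Tj = let j∈Uc , j<1+s = ∈-prefix⁻ (suc s) j∈ in
        ℕₚ.≤∧≮⇒≡ (ℕₚ.≤-pred j<1+s)
                 (λ j<s → x∈p─q⇒x∉q i∈ (∈-unionOf⁺ T (∈-prefix⁺ s j∈Uc j<s) i∈Tj))

      D : Fin m
      D = proj₁ (coveredBy (proj₂ missed))

      Missed⊆D : Missed ⊆ T D
      Missed⊆D i∈ =
        subst (λ j → _ ∈ T j) (Finₚ.toℕ-injective (trans (index≡s i∈) (sym (index≡s (proj₂ missed)))))
              (proj₂ (proj₂ (coveredBy i∈)))

  criticalMember : R ⊆ unionOf T Uc → Nonempty R → CriticalMember T R Uc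
  criticalMember R⊆⋃Uc (r , r∈R) =
    let s , ¬covers , covers = firstStep (λ t → R ⊆? unionOf T (prefix t)) ¬covers₀ {m} covers-m
        open Critical s ¬covers covers
    in record
      { UA       = prefix s
      ; D        = D
      ; UA⊆Uc    = proj₁ ∘ ∈-prefix⁻ s
      ; D∈Uc     = proj₁ (∈-prefix⁻ (suc s) (proj₁ (proj₂ (coveredBy (proj₂ missed)))))
      ; missed   = missed
      ; missed⊆D = Missed⊆D
      }
    where
    ¬covers₀ : ¬ R ⊆ unionOf T (prefix 0)
    ¬covers₀ R⊆⋃ = let _ , j∈ , _ = ∈-unionOf⁻ T (prefix 0) (R⊆⋃ r∈R) in
      case proj₂ (∈-prefix⁻ 0 j∈) of λ ()
    covers-m : R ⊆ unionOf T (prefix m)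
    covers-m = unionOf-mono T (λ {j} j∈Uc → ∈-prefix⁺ m j∈Uc (Finₚ.toℕ<n j)) ∘ R⊆⋃Uc

-- The cost function

module TwoBlocks {n m : ℕ} (T : Fin m → Subset n) (j* : Fin m) (Q : Subset n)
                 {p₀ : Fin n} (p₀∈T* : p₀ ∈ T j*) where

  T* : Subset n
  T* = T j*

  k l : ℚ
  k = size T*
  l = size Q

  opaque
    c : Fin m → ℚ
    c j with j Finₚ.≟ j* | meets? (T j) T* | meets? (T j) Q
    ... | yes _ | _     | _     = k
    ... | no _  | yes _ | _     = k + l + 1ℚ + 1ℚ
    ... | no _  | no _  | yes _ = l
    ... | no _  | no _  | no _  = 0ℚ

  F : Subset n → ℚ
  F S = ifYes (meets? S T*) k + ifYes (meets? S Q) l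

  y : Fin n → ℚ
  y i = 𝟙 T* i + 𝟙 Q i

  k≤k+l+2 : k ≤ k + l + 1ℚ + 1ℚ
  k≤k+l+2 = ≤-trans (p≤p+q (size-nonNeg Q)) (≤-trans (p≤p+q 0≤1) (p≤p+q 0≤1))

  opaque
    unfolding c

    c-nonNeg : ∀ j → 0ℚ ≤ c j
    c-nonNeg j with j Finₚ.≟ j* | meets? (T j) T* | meets? (T j) Q
    ... | yes _ | _     | _     = size-nonNeg T*
    ... | no _  | yes _ | _     = ≤-trans (size-nonNeg T*) k≤k+l+2
    ... | no _  | no _  | yes _ = size-nonNeg Q
    ... | no _  | no _  | no _  = ≤-refl

    c-j* : c j* ≡ k
    c-j* with j* Finₚ.≟ j*
    ... | yes _      = refl
    ... | no j*≢j*   = contradiction refl j*≢j*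

    c-meets-T* : ∀ {j} → j ≢ j* → Meets (T j) T* → c j ≡ k + l + 1ℚ + 1ℚ
    c-meets-T* {j} j≢j* meets with j Finₚ.≟ j* | meets? (T j) T*
    ... | yes j≡j* | _         = contradiction j≡j* j≢j*
    ... | no _     | yes _     = refl
    ... | no _     | no ¬meets = contradiction meets ¬meets

    c-meets-Q : ∀ {j} → j ≢ j* → ¬ Meets (T j) T* → Meets (T j) Q → c j ≡ l
    c-meets-Q {j} j≢j* ¬meets-T* meets-Q with j Finₚ.≟ j* | meets? (T j) T* | meets? (T j) Q
    ... | yes j≡j* | _           | _         = contradiction j≡j* j≢j*
    ... | no _     | yes meets   | _         = contradiction meets ¬meets-T*
    ... | no _     | no _        | yes _     = refl
    ... | no _     | no _        | no ¬meets = contradiction meets-Q ¬meets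

    c-avoiding : ∀ {j} → j ≢ j* → ¬ Meets (T j) T* → ¬ Meets (T j) Q → c j ≡ 0ℚ
    c-avoiding {j} j≢j* ¬meets-T* ¬meets-Q with j Finₚ.≟ j* | meets? (T j) T* | meets? (T j) Q
    ... | yes j≡j* | _         | _         = contradiction j≡j* j≢j*
    ... | no _     | yes meets | _         = contradiction meets ¬meets-T*
    ... | no _     | no _      | yes meets = contradiction meets ¬meets-Q
    ... | no _     | no _      | no _      = refl

    weights≤c : ¬ Meets T* Q → ∀ j → ifYes (meets? (T j) T*) k + ifYes (meets? (T j) Q) l ≤ c j
    weights≤c T*∩Q=∅ j with j Finₚ.≟ j* | meets? (T j) T* | meets? (T j) Q
    ... | yes refl | _     | yes meets = contradiction meets T*∩Q=∅
    ... | yes refl | d     | no _      = subst (_≤ k) (sym (+-identityʳ (ifYes d k)))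
                                                 (ifYes-≤ d (size-nonNeg T*))
    ... | no _     | yes _ | d         = ≤-trans (+-monoʳ-≤ k (ifYes-≤ d (size-nonNeg Q)))
                                                 (≤-trans (p≤p+q 0≤1) (p≤p+q 0≤1))
    ... | no _     | no _  | yes _     = ≤-reflexive (+-identityˡ l)
    ... | no _     | no _  | no _      = ≤-refl

  ¬meets⇒≢j* : ∀ {j} → ¬ Meets (T j) T* → j ≢ j*
  ¬meets⇒≢j* ¬meets refl = ¬meets (p₀ , p₀∈T* , p₀∈T*)

  cost-avoiding : ∀ {U} → (∀ {j} → j ∈ U → ¬ Meets (T j) T* × ¬ Meets (T j) Q) → costOf c U ≡ 0ℚ
  cost-avoiding U-avoids = sumOn-vanish λ j∈U → let ¬meets-T* , ¬meets-Q = U-avoids j∈U in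
    c-avoiding (¬meets⇒≢j* ¬meets-T*) ¬meets-T* ¬meets-Q

  module WithCovers
    (Q-avoids-T* : ∀ {i} → i ∈ Q → i ∉ T*)
    (UA : Subset m) (UA-avoids : ∀ {j} → j ∈ UA → ¬ Meets (T j) T* × ¬ Meets (T j) Q)
    (UA-covers : ∀ {i} → i ∉ T* → i ∉ Q → i ∈ unionOf T UA)
    (UB : Subset m) (UB-covers : ∀ {i} → i ∉ T* → i ∈ unionOf T UB) (UB-cost : costOf c UB ≤ l)
    where

    ¬meets-T*-Q : ∀ {S} → S ⊆ T* → ¬ Meets S Q
    ¬meets-T*-Q S⊆T* (i , i∈S , i∈Q) = Q-avoids-T* i∈Q (S⊆T* i∈S)

    ¬meets-Q-T* : ∀ {S} → S ⊆ Q → ¬ Meets S T*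
    ¬meets-Q-T* S⊆Q (i , i∈S , i∈T*) = Q-avoids-T* (S⊆Q i∈S) i∈T*

    T*∩Q=∅ : ¬ Meets T* Q
    T*∩Q=∅ = ¬meets-T*-Q (λ i∈T* → i∈T*)

    F≤cost : ∀ {S U} → Covers T S U → F S ≤ costOf c U
    F≤cost {S} {U} U-covers = begin
      F S                         ≤⟨ +-mono-≤ (ifYes-meets≤cover T T* (size-nonNeg T*) U-covers)
                                              (ifYes-meets≤cover T Q (size-nonNeg Q) U-covers) ⟩
      sumOn w₁ U + sumOn w₂ U     ≡⟨ sym (sumOn-+ w₁ w₂ U) ⟩
      sumOn (λ j → w₁ j + w₂ j) U ≤⟨ sumOn-mono (weights≤c T*∩Q=∅) U ⟩
      costOf c U                  ∎
      where
      open ≤-Reasoning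
      w₁ w₂ : Fin m → ℚ
      w₁ j = ifYes (meets? (T j) T*) k
      w₂ j = ifYes (meets? (T j) Q) l

    cheapCover : ∀ S → ∃[ U ] Covers T S U × costOf c U ≤ F S
    cheapCover S =
      let U₁ , covers₁ , cost₁ = coverT* (meets? S T*)
          U₂ , covers₂ , cost₂ = coverRest (meets? S Q)
      in U₁ ∪ U₂ , covers covers₁ covers₂ , ≤-trans (costOf-∪ c-nonNeg U₁ U₂) (+-mono-≤ cost₁ cost₂)
      where
      coverT* : (d : Dec (Meets S T*)) →
                ∃[ U ] (∀ {i} → i ∈ S → i ∈ T* → i ∈ unionOf T U) × costOf c U ≤ ifYes d k
      coverT* (yes _)     = ⁅ j* ⁆ , (λ _ → ∈-unionOf⁺ T (x∈⁅x⁆ j*)) , ≤-reflexive (trans (sumOn-⁅⁆ c j*) c-j*)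
      coverT* (no ¬meets) = ∅ₛ , (λ i∈S i∈T* → contradiction (_ , i∈S , i∈T*) ¬meets) , ≤-reflexive (sumOn-∅ c)
      coverRest : (d : Dec (Meets S Q)) →
                  ∃[ U ] (∀ {i} → i ∈ S → i ∉ T* → i ∈ unionOf T U) × costOf c U ≤ ifYes d l
      coverRest (yes _)     = UB , (λ _ → UB-covers) , UB-cost
      coverRest (no ¬meets) = UA , (λ i∈S i∉T* → UA-covers i∉T* (λ i∈Q → ¬meets (_ , i∈S , i∈Q))) ,
                              ≤-reflexive (cost-avoiding UA-avoids)
      covers : ∀ {U₁ U₂} → (∀ {i} → i ∈ S → i ∈ T* → i ∈ unionOf T U₁) →
               (∀ {i} → i ∈ S → i ∉ T* → i ∈ unionOf T U₂) → Covers T S (U₁ ∪ U₂)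
      covers {U₁} {U₂} covers₁ covers₂ {i} i∈S with i ∈? T*
      ... | yes i∈T* = unionOf-mono T (p⊆p∪q U₂) (covers₁ i∈S i∈T*)
      ... | no i∉T*  = unionOf-mono T (q⊆p∪q U₁ U₂) (covers₂ i∈S i∉T*)

    excess≡ : ∀ z S → excess T c z S ≡ F S - sumOn z S
    excess≡ z S = let U , U-covers , U-cost = cheapCover S in
      excess-≡ T c z U-covers U-cost (λ _ → F≤cost)

    fullCover : Subset m
    fullCover = ⁅ j* ⁆ ∪ UB

    fullCover-covers : ∀ p → p ∈ unionOf T fullCover
    fullCover-covers p with p ∈? T*
    ... | yes p∈T* = ∈-unionOf⁺ T (x∈p∪q⁺ (inj₁ (x∈⁅x⁆ j*))) p∈T*
    ... | no p∉T*  = unionOf-mono T (q⊆p∪q ⁅ j* ⁆ UB) (UB-covers p∉T*)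

    fullCover-cost : sumFin (λ j → c j * 𝟙 fullCover j) ≤ k + l
    fullCover-cost = ≤-trans (≤-reflexive (indicator-cost T c fullCover))
      (≤-trans (costOf-∪ c-nonNeg ⁅ j* ⁆ UB) (+-mono-≤ (≤-reflexive (trans (sumOn-⁅⁆ c j*) c-j*)) UB-cost))

    k+l≤lp : ∀ x → LPFeasible T x → k + l ≤ sumFin (λ j → c j * x j)
    k+l≤lp x x-feasible = begin
      k + l                                   ≤⟨ +-mono-≤ (size≤lp T T* x-feasible) (size≤lp T Q x-feasible) ⟩
      sumFin (λ j → w₁ j) + sumFin (λ j → w₂ j) ≡⟨ sym (sumFin-+ w₁ w₂) ⟩
      sumFin (λ j → w₁ j + w₂ j)              ≤⟨ sumFin-mono pointwise ⟩
      sumFin (λ j → c j * x j)                ∎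
      where
      open ≤-Reasoning
      w₁ w₂ : Fin m → ℚ
      w₁ j = ifYes (meets? (T j) T*) k * x j
      w₂ j = ifYes (meets? (T j) Q) l * x j
      pointwise : ∀ j → w₁ j + w₂ j ≤ c j * x j
      pointwise j =
        ≤-trans (≤-reflexive (sym (*-distribʳ-+ (x j) (ifYes (meets? (T j) T*) k) (ifYes (meets? (T j) Q) l))))
                (*-monoʳ-≤-nonNeg (x j) {{nonNegative (proj₁ x-feasible j)}} (weights≤c T*∩Q=∅ j))

    isLPValue : IsLPValue T c (k + l)
    isLPValue =
      (𝟙 fullCover , fullCover-feasible , ≤-antisym fullCover-cost (k+l≤lp _ fullCover-feasible)) , k+l≤lp
      where
      fullCover-feasible : LPFeasible T (𝟙 fullCover)
      fullCover-feasible = indicator-feasible T fullCover-covers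

    admissible-sum : ∀ {z} → Admissible T c z → sumFin z ≡ k + l
    admissible-sum (_ , v , ((x , x-feasible , x-cost) , v≤lp) , Σz≡v) =
      trans Σz≡v (≤-antisym (≤-trans (v≤lp _ (indicator-feasible T fullCover-covers)) fullCover-cost)
                            (subst (k + l ≤_) x-cost (k+l≤lp x x-feasible)))

    Supported : (Fin n → ℚ) → Set
    Supported u = ∀ {i} → i ∉ T* → i ∉ Q → u i ≡ 0ℚ

    sumOn-split : ∀ {u} → Supported u → ∀ S → sumOn u S ≡ sumOn u (S ∩ T*) + sumOn u (S ∩ Q)
    sumOn-split {u} u-supported S = trans (sumFin-cong pointwise) (sumFin-+ (u ↾ (S ∩ T*)) (u ↾ (S ∩ Q)))
      where
      pointwise : ∀ i → (u ↾ S) i ≡ (u ↾ (S ∩ T*)) i + (u ↾ (S ∩ Q)) i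
      pointwise i rewrite lookup-zipWith _∧_ i S T* | lookup-zipWith _∧_ i S Q
        with lookup S i | lookup T* i in i∈?T* | lookup Q i in i∈?Q
      ... | false | _     | _     = refl
      ... | true  | true  | true  = contradiction (lookup⇒∈ i∈?T*) (Q-avoids-T* (lookup⇒∈ i∈?Q))
      ... | true  | true  | false = sym (+-identityʳ (u i))
      ... | true  | false | true  = sym (+-identityˡ (u i))
      ... | true  | false | false = u-supported (lookup⇒∉ i∈?T*) (lookup⇒∉ i∈?Q)

    y-nonNeg : ∀ i → 0ℚ ≤ y i
    y-nonNeg i = +-mono-≤ (if-nonNeg (lookup T* i) 0≤1) (if-nonNeg (lookup Q i) 0≤1)

    y-supported : Supported y
    y-supported i∉T* i∉Q rewrite ∉⇒lookup i∉T* | ∉⇒lookup i∉Q = refl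

    y≡1-T* : ∀ {i} → i ∈ T* → y i ≡ 1ℚ
    y≡1-T* i∈T* rewrite ∈⇒lookup i∈T* | ∉⇒lookup (λ i∈Q → Q-avoids-T* i∈Q i∈T*) = refl

    y≡1-Q : ∀ {i} → i ∈ Q → y i ≡ 1ℚ
    y≡1-Q i∈Q rewrite ∈⇒lookup i∈Q | ∉⇒lookup (Q-avoids-T* i∈Q) = refl

    y-admissible : Admissible T c y
    y-admissible = y-nonNeg , k + l , isLPValue , sumFin-+ (𝟙 T*) (𝟙 Q)

    y-split : ∀ S → sumOn y S ≡ size (S ∩ T*) + size (S ∩ Q)
    y-split S = trans (sumOn-split y-supported S)
      (cong₂ _+_ (sumOn-cong (y≡1-T* ∘ proj₂ ∘ x∈p∩q⁻ S T*))
                 (sumOn-cong (y≡1-Q ∘ proj₂ ∘ x∈p∩q⁻ S Q)))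

    excess-y : ∀ S → excess T c y S ≡ slack T* S + slack Q S
    excess-y S = begin
      excess T c y S                              ≡⟨ excess≡ y S ⟩
      F S - sumOn y S                             ≡⟨ cong (λ t → F S - t) (y-split S) ⟩
      F S - (size (S ∩ T*) + size (S ∩ Q))        ≡⟨ solve 4 (λ a b c d → a :+ b :- (c :+ d) := a :- c :+ (b :- d))
                                                       refl (ifYes (meets? S T*) k) (ifYes (meets? S Q) l)
                                                            (size (S ∩ T*)) (size (S ∩ Q)) ⟩
      slack T* S + slack Q S                      ∎
      where open ≡-Reasoning

    slack-T*≤excess-y : ∀ S → slack T* S ≤ excess T c y S
    slack-T*≤excess-y S =
      subst₂ _≤_ (+-identityʳ (slack T* S)) (sym (excess-y S)) (+-monoʳ-≤ (slack T* S) (slack-nonNeg Q S))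

    slack-Q≤excess-y : ∀ S → slack Q S ≤ excess T c y S
    slack-Q≤excess-y S =
      subst₂ _≤_ (+-identityˡ (slack Q S)) (sym (excess-y S)) (+-monoˡ-≤ (slack Q S) (slack-nonNeg T* S))

    excess-y-nonNeg : ∀ S → 0ℚ ≤ excess T c y S
    excess-y-nonNeg S = ≤-trans (slack-nonNeg T* S) (slack-T*≤excess-y S)

    F≤k : ∀ {S} → S ⊆ T* → F S ≤ k
    F≤k {S} S⊆T* = subst (F S ≤_) (+-identityʳ k)
      (+-mono-≤ (ifYes-≤ (meets? S T*) (size-nonNeg T*))
                (≤-reflexive (ifYes-no (meets? S Q) (¬meets-T*-Q S⊆T*))))

    F≤l : ∀ {S} → S ⊆ Q → F S ≤ l
    F≤l {S} S⊆Q = subst (F S ≤_) (+-identityˡ l)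
      (+-mono-≤ (≤-reflexive (ifYes-no (meets? S T*) (¬meets-Q-T* S⊆Q))) (ifYes-≤ (meets? S Q) (size-nonNeg Q)))

    module Competitor (z : Fin n → ℚ) (z≥0 : ∀ i → 0ℚ ≤ z i) (Σz : sumFin z ≡ k + l)
                      (excess-z≥0 : ∀ {S} → S ∈ₗ coalitions n → 0ℚ ≤ excess T c z S) where

      z≤F : ∀ {S} → S ∈ₗ coalitions n → sumOn z S ≤ F S
      z≤F {S} S∈ = 0≤q-p⇒p≤q (subst (0ℚ ≤_) (excess≡ z S) (excess-z≥0 S∈))

      z-supported : Supported z
      z-supported {r} r∉T* r∉Q =
        ≤-antisym (subst₂ _≤_ (sumOn-⁅⁆ z r) F⁅r⁆≡0 (z≤F (∈-coalitions (x∈⁅x⁆ r)))) (z≥0 r)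
        where
        avoids : ∀ {A} → r ∉ A → ¬ Meets ⁅ r ⁆ A
        avoids r∉A (i , i∈⁅r⁆ , i∈A) = r∉A (subst (_∈ _) (x∈⁅y⁆⇒x≡y r i∈⁅r⁆) i∈A)
        F⁅r⁆≡0 : F ⁅ r ⁆ ≡ 0ℚ
        F⁅r⁆≡0 = cong₂ _+_ (ifYes-no (meets? ⁅ r ⁆ T*) (avoids r∉T*))
                           (ifYes-no (meets? ⁅ r ⁆ Q) (avoids r∉Q))

      z-T*≤k : sumOn z T* ≤ k
      z-T*≤k = ≤-trans (z≤F (∈-coalitions p₀∈T*)) (F≤k (λ i∈T* → i∈T*))

      z-Q≤l : sumOn z Q ≤ l
      z-Q≤l with nonempty? Q
      ... | yes (q , q∈Q) = ≤-trans (z≤F (∈-coalitions q∈Q)) (F≤l (λ i∈Q → i∈Q))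
      ... | no empty      = ≤-reflexive (trans (vanish z) (sym (vanish (λ _ → 1ℚ))))
        where
        vanish : ∀ u → sumOn u Q ≡ 0ℚ
        vanish u = sumOn-vanish (λ i∈Q → contradiction (_ , i∈Q) empty)

      z-blocks : sumOn z T* ≡ k × sumOn z Q ≡ l
      z-blocks = ≤-+-≡⇒≡ z-T*≤k z-Q≤l (begin
        sumOn z T* + sumOn z Q              ≡⟨ sym (cong₂ _+_ (cong (sumOn z) (∩-identityˡ T*))
                                                                  (cong (sumOn z) (∩-identityˡ Q))) ⟩
        sumOn z (Pₛ ∩ T*) + sumOn z (Pₛ ∩ Q) ≡⟨ sym (sumOn-split z-supported Pₛ) ⟩
        sumOn z Pₛ                           ≡⟨ sumOn-Pₛ z ⟩
        sumFin z                             ≡⟨ Σz ⟩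
        k + l                                ∎)
        where open ≡-Reasoning

      excess-y<1⇒excess-z≡0 : ∀ S → excess T c y S < 1ℚ → excess T c z S ≡ 0ℚ
      excess-y<1⇒excess-z≡0 S excess-y<1 =
        trans (excess≡ z S) (trans (cong (λ t → F S - t) z-S≡F) (+-inverseʳ (F S)))
        where
        open ≡-Reasoning
        z-S≡F : sumOn z S ≡ F S
        z-S≡F = begin
          sumOn z S                                                         ≡⟨ sumOn-split z-supported S ⟩
          sumOn z (S ∩ T*) + sumOn z (S ∩ Q)                                ≡⟨ cong₂ _+_
            (sumOn-∩-full z S T* (slack<1⇒⊆ (≤-<-trans (slack-T*≤excess-y S) excess-y<1)))
            (sumOn-∩-full z S Q (slack<1⇒⊆ (≤-<-trans (slack-Q≤excess-y S) excess-y<1))) ⟩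
          ifYes (meets? S T*) (sumOn z T*) + ifYes (meets? S Q) (sumOn z Q) ≡⟨ cong₂ _+_
            (cong (ifYes (meets? S T*)) (proj₁ z-blocks)) (cong (ifYes (meets? S Q)) (proj₂ z-blocks)) ⟩
          F S                                                               ∎

      -- A ∖ p is a coalition on which z has excess z p < 1, while y has excess ≥ 1.
      excessVector-< : ∀ {A p} → sumOn z A ≡ size A → (∀ {S} → S ⊆ A → F S ≤ size A) →
                       (∀ S → slack A S ≤ excess T c y S) → p ∈ A → z p < 1ℚ →
                       excessVector T c z <lex excessVector T c y
      excessVector-< {A} {p} z-A F≤ slack≤ p∈A zp<1 with nonempty? (A ∖ₛ p)
      ... | no empty = contradiction zp≡1 (<⇒≢ zp<1)
        where
        open ≡-Reasoning
        vanish : ∀ (u : Fin n → ℚ) → sumOn u (A ∖ₛ p) ≡ 0ℚ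
        vanish u = sumOn-vanish (λ i∈ → contradiction (_ , i∈) empty)
        zp≡1 : z p ≡ 1ℚ
        zp≡1 = begin
          z p                             ≡⟨ sym (+-identityˡ (z p)) ⟩
          0ℚ + z p                        ≡⟨ cong (_+ z p) (sym (vanish z)) ⟩
          sumOn z (A ∖ₛ p) + z p          ≡⟨ sumOn-remove z p∈A ⟩
          sumOn z A                       ≡⟨ z-A ⟩
          size A                          ≡⟨ sym (sumOn-remove (λ _ → 1ℚ) p∈A) ⟩
          size (A ∖ₛ p) + 1ℚ              ≡⟨ cong (_+ 1ℚ) (vanish (λ _ → 1ℚ)) ⟩
          0ℚ + 1ℚ                         ≡⟨ +-identityˡ 1ℚ ⟩
          1ℚ                              ∎
      ... | yes (p′ , p′∈A-p) =
        sort-<lex-threshold (coalitions n) (excess T c z) (excess T c y) excess-z≥0 dichotomy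
          (∈-coalitions p′∈A-p) excess-z<1 1≤excess-y
        where
        excess-z<1 : excess T c z (A ∖ₛ p) < 1ℚ
        excess-z<1 = begin-strict
          excess T c z (A ∖ₛ p)    ≡⟨ excess≡ z (A ∖ₛ p) ⟩
          F (A ∖ₛ p) - sumOn z (A ∖ₛ p) ≤⟨ p≤q+r⇒p-q≤r (≤-trans (F≤ (p─q⊆p A ⁅ p ⁆))
                                                          (≤-reflexive (trans (sym z-A) (sym (sumOn-remove z p∈A))))) ⟩
          z p                      <⟨ zp<1 ⟩
          1ℚ                       ∎
          where open ≤-Reasoning
        1≤excess-y : 1ℚ ≤ excess T c y (A ∖ₛ p)
        1≤excess-y = ≤-trans (slack≥1 p∈A (λ p∈A-p → x∈p-y⇒x≢y p∈A-p refl)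
                                      (p′ , p′∈A-p , p─q⊆p A ⁅ p ⁆ p′∈A-p))
                             (slack≤ (A ∖ₛ p))
        dichotomy : ∀ {S} → S ∈ₗ coalitions n →
                    1ℚ ≤ excess T c y S ⊎ (excess T c z S ≡ 0ℚ × 0ℚ ≤ excess T c y S)
        dichotomy {S} _ with 1ℚ ≤? excess T c y S
        ... | yes 1≤excess = inj₁ 1≤excess
        ... | no 1≰excess  = inj₂ (excess-y<1⇒excess-z≡0 S (≰⇒> 1≰excess) , excess-y-nonNeg S)

      y≡z : (∀ {p} → p ∈ T* ⊎ p ∈ Q → 1ℚ ≤ z p) → ∀ i → y i ≡ z i
      y≡z 1≤z = sumFin-mono-≡ y≤z (trans (sumFin-+ (𝟙 T*) (𝟙 Q)) (sym Σz))
        where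
        y≤z : ∀ i → y i ≤ z i
        y≤z i with i ∈? T* | i ∈? Q
        ... | yes i∈T* | _       = subst (_≤ z i) (sym (y≡1-T* i∈T*)) (1≤z (inj₁ i∈T*))
        ... | no _     | yes i∈Q = subst (_≤ z i) (sym (y≡1-Q i∈Q)) (1≤z (inj₂ i∈Q))
        ... | no i∉T*  | no i∉Q  = ≤-reflexive (trans (y-supported i∉T* i∉Q) (sym (z-supported i∉T* i∉Q)))

      excessVector-≤ : excessVector T c z ≤lex excessVector T c y
      excessVector-≤ with Finₚ.any? (λ p → ((p ∈? T*) ⊎-dec (p ∈? Q)) ×-dec (z p <? 1ℚ))
      ... | yes (p , inj₁ p∈T* , zp<1) =
        <lex⇒≤lex (excessVector-< (proj₁ z-blocks) F≤k slack-T*≤excess-y p∈T* zp<1)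
      ... | yes (p , inj₂ p∈Q , zp<1)  =
        <lex⇒≤lex (excessVector-< (proj₂ z-blocks) F≤l slack-Q≤excess-y p∈Q zp<1)
      ... | no none = subst (λ θ → excessVector T c z ≤lex sort θ)
                            (Listₚ.map-cong excess-z≡excess-y (coalitions n)) (≤lex-refl (excessVector T c z))
        where
        excess-z≡excess-y : ∀ S → excess T c z S ≡ excess T c y S
        excess-z≡excess-y S = trans (excess≡ z S)
          (trans (cong (λ t → F S - t) (sumOn-cong {S = S} (λ {i} _ → sym (y≡z 1≤z i)))) (sym (excess≡ y S)))
          where
          1≤z : ∀ {p} → p ∈ T* ⊎ p ∈ Q → 1ℚ ≤ z p
          1≤z p∈ = ≮⇒≥ (λ zp<1 → none (_ , p∈ , zp<1))

    y-nucleolus : IsHappyNucleolus T c y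
    y-nucleolus = y-admissible , λ z z-admissible →
      excessVector-≤ z (proj₁ z-admissible) (admissible-sum z-admissible)
      where
      excessVector-≤ : ∀ z → (∀ i → 0ℚ ≤ z i) → sumFin z ≡ k + l →
                       excessVector T c z ≤lex excessVector T c y
      excessVector-≤ z z≥0 Σz with Any.any? (λ S → excess T c z S <? 0ℚ) (coalitions n)
      ... | yes negative = let S , S∈ , excess<0 = find negative in
        <lex⇒≤lex (sort-<lex-negative (coalitions n) (excess T c z) (excess T c y) S∈ excess<0
                                      (λ _ → excess-y-nonNeg _))
      ... | no none = Competitor.excessVector-≤ z z≥0 Σz (λ S∈ → ≮⇒≥ (λ excess<0 → none (lose S∈ excess<0)))

    excessPair-⁅⁆ : ∀ (u : Fin n → ℚ) j S → excessPair c u (S , ⁅ j ⁆) ≡ c j - sumOn u S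
    excessPair-⁅⁆ u j S = cong (_- sumOn u S) (sumOn-⁅⁆ c j)

    y≤c : ∀ {j S} → S ⊆ T j → sumOn y S ≤ c j
    y≤c {j} {S} S⊆Tj = begin
      sumOn y S   ≤⟨ 0≤q-p⇒p≤q (subst (0ℚ ≤_) (excess≡ y S) (excess-y-nonNeg S)) ⟩
      F S         ≤⟨ F≤cost (⁅⁆-covers T S⊆Tj) ⟩
      costOf c ⁅ j ⁆ ≡⟨ sumOn-⁅⁆ c j ⟩
      c j         ∎
      where open ≤-Reasoning

    2≤excess-meets-T* : ∀ {u : Fin n → ℚ} {j} → (∀ i → 0ℚ ≤ u i) → sumFin u ≡ k + l →
                        j ≢ j* → Meets (T j) T* → ∀ (S : Subset n) → 1ℚ + 1ℚ ≤ c j - sumOn u S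
    2≤excess-meets-T* {u} {j} u≥0 Σu j≢j* meets S = p+q≤r⇒q≤r-p (begin
      sumOn u S + (1ℚ + 1ℚ)   ≤⟨ +-monoˡ-≤ (1ℚ + 1ℚ) (≤-trans (sumOn≤sumFin u≥0 S) (≤-reflexive Σu)) ⟩
      k + l + (1ℚ + 1ℚ)       ≡⟨ sym (+-assoc (k + l) 1ℚ 1ℚ) ⟩
      k + l + 1ℚ + 1ℚ         ≡⟨ sym (c-meets-T* j≢j* meets) ⟩
      c j                     ∎)
      where open ≤-Reasoning

    sumOn-avoiding : ∀ {u : Fin n → ℚ} → Supported u → ∀ {j S} → S ⊆ T j →
                     ¬ Meets (T j) T* → ¬ Meets (T j) Q → sumOn u S ≡ 0ℚ
    sumOn-avoiding u-supported S⊆Tj ¬meets-T* ¬meets-Q = sumOn-vanish λ i∈S →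
      u-supported (λ i∈T* → ¬meets-T* (_ , S⊆Tj i∈S , i∈T*)) (λ i∈Q → ¬meets-Q (_ , S⊆Tj i∈S , i∈Q))

    ¬Determines-without : ∀ {x} {z : Fin n → ℚ} {w} → Admissible T c z →
      (∀ {j S} → S ⊆ T j → (S , ⁅ j ⁆) ≢ x →
                 w ≤ c j - sumOn z S ⊎ (c j - sumOn y S ≡ 0ℚ × 0ℚ ≤ c j - sumOn z S)) →
      ∀ {j₀ S₀ i₀} → i₀ ∈ S₀ → S₀ ⊆ T j₀ → (S₀ , ⁅ j₀ ⁆) ≢ x →
      c j₀ - sumOn y S₀ < w → w ≤ c j₀ - sumOn z S₀ → ¬ Determines T c (removePair (simpleFamily T) x)
    ¬Determines-without {x} {z} {w} z-admissible dichotomy {j₀} {S₀} i₀∈S₀ S₀⊆T pair₀≢x y-pair₀<w w≤z-pair₀ =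
      <lex⇒¬Determines y-nucleolus z-admissible
        (sort-<lex-threshold L (excessPair c y) (excessPair c z) y-pair≥0 dichotomy′
          (∈-removePair-simpleFamily⁺ T x i₀∈S₀ S₀⊆T pair₀≢x)
          (subst (_< w) (sym (excessPair-⁅⁆ y j₀ S₀)) y-pair₀<w)
          (subst (w ≤_) (sym (excessPair-⁅⁆ z j₀ S₀)) w≤z-pair₀))
      where
      L : List (Subset n × Subset m)
      L = removePair (simpleFamily T) x
      y-pair≥0 : ∀ {a} → a ∈ₗ L → 0ℚ ≤ excessPair c y a
      y-pair≥0 a∈L with ∈-removePair-simpleFamily⁻ T x a∈L
      ... | j , S , refl , S⊆Tj , _ = subst (0ℚ ≤_) (sym (excessPair-⁅⁆ y j S)) (p≤q⇒0≤q-p (y≤c S⊆Tj))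
      dichotomy′ : ∀ {a} → a ∈ₗ L →
                   w ≤ excessPair c z a ⊎ (excessPair c y a ≡ 0ℚ × 0ℚ ≤ excessPair c z a)
      dichotomy′ a∈L with ∈-removePair-simpleFamily⁻ T x a∈L
      ... | j , S , refl , S⊆Tj , pair≢x with dichotomy S⊆Tj pair≢x
      ...   | inj₁ w≤z-pair           = inj₁ (subst (w ≤_) (sym (excessPair-⁅⁆ z j S)) w≤z-pair)
      ...   | inj₂ (y-pair≡0 , z-pair≥0) =
        inj₂ (trans (excessPair-⁅⁆ y j S) y-pair≡0 , subst (0ℚ ≤_) (sym (excessPair-⁅⁆ z j S)) z-pair≥0)

module RemovingWholeSet {n m : ℕ} (T : Fin m → Subset n) (j* : Fin m) {Uc : Subset m}
  (Uc-avoids : ∀ j → j ∈ Uc → T j ⊆ ∁ (T j*)) {p₀ : Fin n} (p₀∈T* : p₀ ∈ T j*)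
  (critical : CriticalMember T (∁ (T j*)) Uc) where

  open CriticalMember critical

  Q : Subset n
  Q = ∁ (T j*) ─ unionOf T UA

  private
    r′ : Fin n
    r′ = proj₁ missed

    r′∈Q : r′ ∈ Q
    r′∈Q = proj₂ missed

    Q⊆TD : Q ⊆ T D
    Q⊆TD = missed⊆D

  open TwoBlocks T j* Q p₀∈T* hiding (c; c-nonNeg)
  open TwoBlocks T j* Q p₀∈T* public using (c; c-nonNeg)

  private
    Q-avoids-T* : ∀ {i} → i ∈ Q → i ∉ T*
    Q-avoids-T* i∈Q = x∈∁p⇒x∉p (p─q⊆p (∁ T*) (unionOf T UA) i∈Q)

    Uc-avoids-T* : ∀ {j} → j ∈ Uc → ¬ Meets (T j) T*
    Uc-avoids-T* j∈Uc (i , i∈Tj , i∈T*) = x∈∁p⇒x∉p (Uc-avoids _ j∈Uc i∈Tj) i∈T*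

    UA-avoids : ∀ {j} → j ∈ UA → ¬ Meets (T j) T* × ¬ Meets (T j) Q
    UA-avoids j∈UA = Uc-avoids-T* (UA⊆Uc j∈UA) ,
                     λ (i , i∈Tj , i∈Q) → x∈p─q⇒x∉q i∈Q (∈-unionOf⁺ T j∈UA i∈Tj)

    UA-covers : ∀ {i} → i ∉ T* → i ∉ Q → i ∈ unionOf T UA
    UA-covers {i} i∉T* i∉Q with i ∈? unionOf T UA
    ... | yes i∈⋃ = i∈⋃
    ... | no i∉⋃  = contradiction (x∈p∧x∉q⇒x∈p─q (x∉p⇒x∈∁p i∉T*) i∉⋃) i∉Q

    UB : Subset m
    UB = UA ∪ ⁅ D ⁆

    UB-covers : ∀ {i} → i ∉ T* → i ∈ unionOf T UB
    UB-covers {i} i∉T* with i ∈? Q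
    ... | yes i∈Q = ∈-unionOf⁺ T (x∈p∪q⁺ (inj₂ (x∈⁅x⁆ D))) (Q⊆TD i∈Q)
    ... | no i∉Q  = unionOf-mono T (p⊆p∪q ⁅ D ⁆) (UA-covers i∉T* i∉Q)

    c-D : c D ≡ l
    c-D = c-meets-Q (¬meets⇒≢j* (Uc-avoids-T* D∈Uc)) (Uc-avoids-T* D∈Uc) (r′ , Q⊆TD r′∈Q , r′∈Q)

    UB-cost : costOf c UB ≤ l
    UB-cost = ≤-trans (costOf-∪ c-nonNeg UA ⁅ D ⁆)
      (≤-reflexive (trans (cong₂ _+_ (cost-avoiding UA-avoids) (trans (sumOn-⁅⁆ c D) c-D)) (+-identityˡ l)))

  open WithCovers Q-avoids-T* UA UA-avoids UA-covers UB UB-covers UB-cost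

  z : Fin n → ℚ
  z i = y i + ifYes (i Finₚ.≟ p₀) ½ - ifYes (i Finₚ.≟ r′) ½

  private
    sumOn-z : ∀ S → sumOn z S ≡ sumOn y S + ifYes (p₀ ∈? S) ½ - ifYes (r′ ∈? S) ½
    sumOn-z S = begin
      sumOn z S                                                ≡⟨ sumOn-+ (λ i → y i + at p₀ i) (λ i → - at r′ i) S ⟩
      sumOn (λ i → y i + at p₀ i) S + sumOn (λ i → - at r′ i) S ≡⟨ cong₂ _+_ (sumOn-+ y (at p₀) S)
                                                                              (sumOn-neg (at r′) S) ⟩
      sumOn y S + sumOn (at p₀) S - sumOn (at r′) S             ≡⟨ cong₂ (λ a b → sumOn y S + a - b)
                                                                     (sumOn-point ½ p₀ S) (sumOn-point ½ r′ S) ⟩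
      sumOn y S + ifYes (p₀ ∈? S) ½ - ifYes (r′ ∈? S) ½        ∎
      where
      open ≡-Reasoning
      at : Fin n → Fin n → ℚ
      at p i = ifYes (i Finₚ.≟ p) ½

    z≤y+½ : ∀ S → sumOn z S ≤ sumOn y S + ½
    z≤y+½ S = ≤-trans (≤-reflexive (sumOn-z S))
      (≤-trans (p-q≤p (ifYes-nonNeg (r′ ∈? S) 0≤½)) (+-monoʳ-≤ (sumOn y S) (ifYes-≤ (p₀ ∈? S) 0≤½)))

    z-without-p₀ : ∀ {S} → p₀ ∉ S → sumOn z S ≡ sumOn y S - ifYes (r′ ∈? S) ½
    z-without-p₀ {S} p₀∉S = trans (sumOn-z S) (cong (λ a → a - ifYes (r′ ∈? S) ½)
      (trans (cong (sumOn y S +_) (ifYes-no (p₀ ∈? S) p₀∉S)) (+-identityʳ (sumOn y S))))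

    z≤y : ∀ {S} → p₀ ∉ S → sumOn z S ≤ sumOn y S
    z≤y {S} p₀∉S = ≤-trans (≤-reflexive (z-without-p₀ p₀∉S)) (p-q≤p (ifYes-nonNeg (r′ ∈? S) 0≤½))

    r′≢p₀ : r′ ≢ p₀
    r′≢p₀ refl = Q-avoids-T* r′∈Q p₀∈T*

    z-r′≡½ : z r′ ≡ ½
    z-r′≡½ = cong₂ _-_ (cong₂ _+_ (y≡1-Q r′∈Q) (ifYes-no (r′ Finₚ.≟ p₀) r′≢p₀))
                       (ifYes-yes (r′ Finₚ.≟ r′) refl)

    z-i : ∀ {i} → i ≢ r′ → z i ≡ y i + ifYes (i Finₚ.≟ p₀) ½
    z-i {i} i≢r′ =
      trans (cong (λ b → y i + ifYes (i Finₚ.≟ p₀) ½ - b) (ifYes-no (i Finₚ.≟ r′) i≢r′)) (+-identityʳ _)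

    z≥0 : ∀ i → 0ℚ ≤ z i
    z≥0 i = case i Finₚ.≟ r′ of λ where
      (yes i≡r′) → subst (λ i → 0ℚ ≤ z i) (sym i≡r′) (subst (0ℚ ≤_) (sym z-r′≡½) 0≤½)
      (no i≢r′)  → subst (0ℚ ≤_) (sym (z-i i≢r′))
                     (+-mono-≤ (y-nonNeg i) (ifYes-nonNeg (i Finₚ.≟ p₀) 0≤½))

    Σz : sumFin z ≡ k + l
    Σz = begin
      sumFin z                                            ≡⟨ sym (sumOn-Pₛ z) ⟩
      sumOn z Pₛ                                          ≡⟨ sumOn-z Pₛ ⟩
      sumOn y Pₛ + ifYes (p₀ ∈? Pₛ) ½ - ifYes (r′ ∈? Pₛ) ½ ≡⟨ cong₂ (λ a b → sumOn y Pₛ + a - b)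
                                                          (ifYes-yes (p₀ ∈? Pₛ) ∈⊤) (ifYes-yes (r′ ∈? Pₛ) ∈⊤) ⟩
      sumOn y Pₛ + ½ - ½                                  ≡⟨ solve 1 (λ Y → Y :+ con ½ :- con ½ := Y) refl
                                                                     (sumOn y Pₛ) ⟩
      sumOn y Pₛ                                          ≡⟨ sumOn-Pₛ y ⟩
      sumFin y                                            ≡⟨ sumFin-+ (𝟙 T*) (𝟙 Q) ⟩
      k + l                                               ∎
      where open ≡-Reasoning

    z-admissible : Admissible T c z
    z-admissible = z≥0 , k + l , isLPValue , Σz

    z-supported : Supported z
    z-supported {i} i∉T* i∉Q =
      cong₂ _-_ (cong₂ _+_ (y-supported i∉T* i∉Q) (ifYes-no (i Finₚ.≟ p₀) (λ { refl → i∉T* p₀∈T* })))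
                (ifYes-no (i Finₚ.≟ r′) (λ { refl → i∉Q r′∈Q }))

    ½≤2 : ½ ≤ 1ℚ + 1ℚ
    ½≤2 = from-yes (½ ≤? 1ℚ + 1ℚ)

    ½≤excess-T* : ∀ {S} → S ⊆ T* → S ≢ T* → ½ ≤ c j* - sumOn z S
    ½≤excess-T* {S} S⊆T* S≢T* with Finₚ.any? (λ p → (p ∈? T*) ×-dec ¬? (p ∈? S))
    ... | no none = contradiction (⊆-antisym S⊆T* T*⊆S) S≢T*
      where
      T*⊆S : T* ⊆ S
      T*⊆S {p} p∈T* with p ∈? S
      ... | yes p∈S = p∈S
      ... | no p∉S  = contradiction (p , p∈T* , p∉S) none
    ... | yes (p , p∈T* , p∉S) = p+q≤r⇒q≤r-p (begin
      sumOn z S + ½       ≤⟨ +-monoˡ-≤ ½ (z≤y+½ S) ⟩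
      sumOn y S + ½ + ½   ≡⟨ +-assoc (sumOn y S) ½ ½ ⟩
      sumOn y S + 1ℚ      ≡⟨ cong (sumOn y S +_) (sym (y≡1-T* p∈T*)) ⟩
      sumOn y S + y p     ≤⟨ sumOn-⊆-miss y-nonNeg S⊆T* p∈T* p∉S ⟩
      sumOn y T*          ≡⟨ sumOn-cong y≡1-T* ⟩
      k                   ≡⟨ sym c-j* ⟩
      c j*                ∎)
      where open ≤-Reasoning

    ½≤excess-Q : ∀ {j S} → S ⊆ T j → j ≢ j* → ¬ Meets (T j) T* → Meets (T j) Q → ½ ≤ c j - sumOn z S
    ½≤excess-Q {j} {S} S⊆Tj j≢j* ¬meets-T* meets-Q =
      p+q≤r⇒q≤r-p (subst (sumOn z S + ½ ≤_) (sym (c-meets-Q j≢j* ¬meets-T* meets-Q)) (z+½≤l (r′ ∈? S)))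
      where
      open ≤-Reasoning
      p₀∉S : p₀ ∉ S
      p₀∉S p₀∈S = ¬meets-T* (p₀ , S⊆Tj p₀∈S , p₀∈T*)
      y-S : sumOn y S ≡ size (S ∩ Q)
      y-S = trans (y-split S) (trans (cong (_+ size (S ∩ Q)) (sumOn-vanish λ i∈S∩T* →
              let i∈S , i∈T* = x∈p∩q⁻ S T* i∈S∩T* in ⊥-elim (¬meets-T* (_ , S⊆Tj i∈S , i∈T*))))
            (+-identityˡ (size (S ∩ Q))))
      z+½≤l : Dec (r′ ∈ S) → sumOn z S + ½ ≤ l
      z+½≤l (yes r′∈S) = begin
        sumOn z S + ½              ≡⟨ cong (_+ ½) (trans (z-without-p₀ p₀∉S)
                                              (cong (λ b → sumOn y S - b) (ifYes-yes (r′ ∈? S) r′∈S))) ⟩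
        sumOn y S - ½ + ½          ≡⟨ solve 1 (λ Y → Y :- con ½ :+ con ½ := Y) refl (sumOn y S) ⟩
        sumOn y S                  ≤⟨ subst (sumOn y S ≤_) (c-meets-Q j≢j* ¬meets-T* meets-Q) (y≤c S⊆Tj) ⟩
        l                          ∎
      z+½≤l (no r′∉S) = begin
        sumOn z S + ½              ≤⟨ +-monoˡ-≤ ½ (z≤y p₀∉S) ⟩
        sumOn y S + ½              ≤⟨ +-monoʳ-≤ (sumOn y S) (from-yes (½ ≤? 1ℚ)) ⟩
        sumOn y S + 1ℚ             ≡⟨ cong (_+ 1ℚ) y-S ⟩
        size (S ∩ Q) + 1ℚ          ≤⟨ sumOn-∩-miss (λ _ → 0≤1) S r′∈Q r′∉S ⟩
        l                          ∎

    dichotomy : ∀ {j S} → S ⊆ T j → (S , ⁅ j ⁆) ≢ (T* , ⁅ j* ⁆) →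
                ½ ≤ c j - sumOn z S ⊎ (c j - sumOn y S ≡ 0ℚ × 0ℚ ≤ c j - sumOn z S)
    dichotomy {j} {S} S⊆Tj pair≢ with j Finₚ.≟ j*
    ... | yes refl = inj₁ (½≤excess-T* S⊆Tj (λ S≡T* → pair≢ (cong (_, ⁅ j* ⁆) S≡T*)))
    ... | no j≢j* with meets? (T j) T*
    ...   | yes meets-T* = inj₁ (≤-trans ½≤2 (2≤excess-meets-T* z≥0 Σz j≢j* meets-T* S))
    ...   | no ¬meets-T* with meets? (T j) Q
    ...     | yes meets-Q = inj₁ (½≤excess-Q S⊆Tj j≢j* ¬meets-T* meets-Q)
    ...     | no ¬meets-Q rewrite c-avoiding j≢j* ¬meets-T* ¬meets-Q
                                | sumOn-avoiding y-supported S⊆Tj ¬meets-T* ¬meets-Q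
                                | sumOn-avoiding z-supported S⊆Tj ¬meets-T* ¬meets-Q = inj₂ (refl , ≤-refl)

  ¬determines : ¬ Determines T c (removePair (simpleFamily T) (T* , ⁅ j* ⁆))
  ¬determines = ¬Determines-without z-admissible dichotomy r′∈Q Q⊆TD
    (λ pair≡ → Q-avoids-T* r′∈Q (subst (r′ ∈_) (cong proj₁ pair≡) r′∈Q))
    (subst (_< ½) (sym y-pair≡0) (from-yes (0ℚ <? ½)))
    (≤-reflexive (sym z-pair≡½))
    where
    y-Q : sumOn y Q ≡ l
    y-Q = sumOn-cong y≡1-Q
    y-pair≡0 : c D - sumOn y Q ≡ 0ℚ
    y-pair≡0 = trans (cong₂ _-_ c-D y-Q) (+-inverseʳ l)
    z-pair≡½ : c D - sumOn z Q ≡ ½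
    z-pair≡½ = begin
      c D - sumOn z Q                     ≡⟨ cong₂ _-_ c-D (z-without-p₀ (λ p₀∈Q → Q-avoids-T* p₀∈Q p₀∈T*)) ⟩
      l - (sumOn y Q - ifYes (r′ ∈? Q) ½) ≡⟨ cong₂ (λ a b → l - (a - b)) y-Q (ifYes-yes (r′ ∈? Q) r′∈Q) ⟩
      l - (l - ½)                         ≡⟨ solve 1 (λ l → l :- (l :- con ½) := con ½) refl l ⟩
      ½                                   ∎
      where open ≡-Reasoning

module RemovingOnePoint {n m : ℕ} (T : Fin m → Subset n) (j* : Fin m) {Uc : Subset m}
  (Uc-avoids : ∀ j → j ∈ Uc → T j ⊆ ∁ (T j*)) (Uc-covers : Covers T (∁ (T j*)) Uc)
  {p* p₁ : Fin n} (p*∈T* : p* ∈ T j*) (p₁∈T*-p* : p₁ ∈ T j* ∖ₛ p*) where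

  open TwoBlocks T j* ∅ₛ p*∈T* hiding (c; c-nonNeg)
  open TwoBlocks T j* ∅ₛ p*∈T* public using (c; c-nonNeg)

  private
    ¬meets-∅ : ∀ {A : Subset n} → ¬ Meets A ∅ₛ
    ¬meets-∅ (_ , _ , i∈∅) = ∉⊥ i∈∅

    Uc-avoids′ : ∀ {j} → j ∈ Uc → ¬ Meets (T j) T* × ¬ Meets (T j) ∅ₛ
    Uc-avoids′ j∈Uc = (λ (i , i∈Tj , i∈T*) → x∈∁p⇒x∉p (Uc-avoids _ j∈Uc i∈Tj) i∈T*) , ¬meets-∅

    l≡0 : l ≡ 0ℚ
    l≡0 = sumOn-∅ {n} (λ _ → 1ℚ)

  open WithCovers (λ i∈∅ → contradiction i∈∅ ∉⊥) Uc Uc-avoids′ (λ i∉T* _ → Uc-covers (x∉p⇒x∈∁p i∉T*))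
                  Uc (Uc-covers ∘ x∉p⇒x∈∁p)
                  (≤-reflexive (trans (cost-avoiding Uc-avoids′) (sym l≡0)))

  private
    K : ℚ
    K = size (T* ∖ₛ p*)

    1≤K : 1ℚ ≤ K
    1≤K = term≤sumOn (λ _ → 0≤1) p₁∈T*-p*

    0<K : 0ℚ < K
    0<K = <-≤-trans (from-yes (0ℚ <? 1ℚ)) 1≤K

    instance
      K≢0 : NonZero K
      K≢0 = pos⇒nonZero K {{positive 0<K}}

    0<1/K : 0ℚ < 1/ K
    0<1/K = positive⁻¹ (1/ K) {{1/pos⇒pos K {{positive 0<K}}}}

    K+1≡k : K + 1ℚ ≡ k
    K+1≡k = sumOn-remove (λ _ → 1ℚ) p*∈T*

  -- w = k / (k - 1), so that z has total weight k.
  w : ℚ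
  w = 1ℚ + 1/ K

  z : Fin n → ℚ
  z i = w * 𝟙 (T* ∖ₛ p*) i

  private
    0≤w : 0ℚ ≤ w
    0≤w = ≤-trans 0≤1 (p≤p+q (<⇒≤ 0<1/K))

    1<w : 1ℚ < w
    1<w = subst (_< w) (+-identityʳ 1ℚ) (+-monoʳ-< 1ℚ 0<1/K)

    w≤2 : w ≤ 1ℚ + 1ℚ
    w≤2 = +-monoʳ-≤ 1ℚ (begin
      1/ K             ≡⟨ sym (*-identityʳ (1/ K)) ⟩
      1/ K * 1ℚ        ≤⟨ *-monoˡ-≤-nonNeg (1/ K) {{nonNegative (<⇒≤ 0<1/K)}} 1≤K ⟩
      1/ K * K         ≡⟨ *-inverseˡ K ⟩
      1ℚ               ∎)
      where open ≤-Reasoning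

    z-p : ∀ {p} → p ∈ T* ∖ₛ p* → z p ≡ w
    z-p p∈ = trans (cong (λ b → w * (if b then 1ℚ else 0ℚ)) (∈⇒lookup p∈)) (*-identityʳ w)

    z-supported : Supported z
    z-supported {i} i∉T* _ =
      trans (cong (λ b → w * (if b then 1ℚ else 0ℚ)) (∉⇒lookup (i∉T* ∘ p─q⊆p T* ⁅ p* ⁆))) (*-zeroʳ w)

    z≥0 : ∀ i → 0ℚ ≤ z i
    z≥0 i = subst (_≤ z i) (*-zeroʳ w)
                  (*-monoˡ-≤-nonNeg w {{nonNegative 0≤w}} (if-nonNeg (lookup (T* ∖ₛ p*) i) 0≤1))

    Σz : sumFin z ≡ k + l
    Σz = begin
      sumFin z            ≡⟨ sumFin-*ˡ w (𝟙 (T* ∖ₛ p*)) ⟩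
      w * K               ≡⟨ *-distribʳ-+ K 1ℚ (1/ K) ⟩
      1ℚ * K + 1/ K * K   ≡⟨ cong₂ _+_ (*-identityˡ K) (*-inverseˡ K) ⟩
      K + 1ℚ              ≡⟨ K+1≡k ⟩
      k                   ≡⟨ sym (+-identityʳ k) ⟩
      k + 0ℚ              ≡⟨ cong (k +_) (sym l≡0) ⟩
      k + l               ∎
      where open ≡-Reasoning

    z-admissible : Admissible T c z
    z-admissible = z≥0 , k + l , isLPValue , Σz

    z-T* : sumOn z T* ≡ k
    z-T* = trans (sumOn-supported (λ i∉T* → z-supported i∉T* ∉⊥))
                 (trans Σz (trans (cong (k +_) l≡0) (+-identityʳ k)))

    y-T* : sumOn y T* ≡ k
    y-T* = sumOn-cong y≡1-T*

    w≤excess-T* : ∀ {S} → S ⊆ T* → S ≢ T* ∖ₛ p* →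
                  w ≤ c j* - sumOn z S ⊎ (c j* - sumOn y S ≡ 0ℚ × 0ℚ ≤ c j* - sumOn z S)
    w≤excess-T* {S} S⊆T* S≢T*-p*
      with Finₚ.any? (λ p → (p ∈? T*) ×-dec (¬? (p ∈? S) ×-dec ¬? (p Finₚ.≟ p*)))
    ... | yes (p , p∈T* , p∉S , p≢p*) = inj₁ (p+q≤r⇒q≤r-p (begin
      sumOn z S + w       ≡⟨ cong (sumOn z S +_) (sym (z-p (x∈p∧x≢y⇒x∈p-y p∈T* p≢p*))) ⟩
      sumOn z S + z p     ≤⟨ sumOn-⊆-miss z≥0 S⊆T* p∈T* p∉S ⟩
      sumOn z T*          ≡⟨ trans z-T* (sym c-j*) ⟩
      c j*                ∎))
      where open ≤-Reasoning
    ... | no none with p* ∈? S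
    ...   | yes p*∈S =
      inj₂ (subst (λ S → c j* - sumOn y S ≡ 0ℚ × 0ℚ ≤ c j* - sumOn z S) (⊆-antisym T*⊆S S⊆T*) tight)
      where
      tight : c j* - sumOn y T* ≡ 0ℚ × 0ℚ ≤ c j* - sumOn z T*
      tight = trans (cong₂ _-_ c-j* y-T*) (+-inverseʳ k) ,
              ≤-reflexive (sym (trans (cong₂ _-_ c-j* z-T*) (+-inverseʳ k)))
      T*⊆S : T* ⊆ S
      T*⊆S {p} p∈T* with p ∈? S | p Finₚ.≟ p*
      ... | yes p∈S | _        = p∈S
      ... | no _    | yes refl = p*∈S
      ... | no p∉S  | no p≢p*  = contradiction (p , p∈T* , p∉S , p≢p*) none
    ...   | no p*∉S = contradiction (⊆-antisym (⊆-∖ₛ S⊆T* p*∉S) T*-p*⊆S) S≢T*-p*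
      where
      T*-p*⊆S : T* ∖ₛ p* ⊆ S
      T*-p*⊆S {p} p∈ with p ∈? S
      ... | yes p∈S = p∈S
      ... | no p∉S  = contradiction (p , p─q⊆p T* ⁅ p* ⁆ p∈ , p∉S , x∈p-y⇒x≢y p∈) none

    dichotomy : ∀ {j S} → S ⊆ T j → (S , ⁅ j ⁆) ≢ (T* ∖ₛ p* , ⁅ j* ⁆) →
                w ≤ c j - sumOn z S ⊎ (c j - sumOn y S ≡ 0ℚ × 0ℚ ≤ c j - sumOn z S)
    dichotomy {j} {S} S⊆Tj pair≢ with j Finₚ.≟ j*
    ... | yes refl = w≤excess-T* S⊆Tj (λ S≡T*-p* → pair≢ (cong (_, ⁅ j* ⁆) S≡T*-p*))
    ... | no j≢j* with meets? (T j) T*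
    ...   | yes meets-T* = inj₁ (≤-trans w≤2 (2≤excess-meets-T* z≥0 Σz j≢j* meets-T* S))
    ...   | no ¬meets-T* rewrite c-avoiding j≢j* ¬meets-T* ¬meets-∅
                               | sumOn-avoiding y-supported S⊆Tj ¬meets-T* ¬meets-∅
                               | sumOn-avoiding z-supported S⊆Tj ¬meets-T* ¬meets-∅ = inj₂ (refl , ≤-refl)

  ¬determines : ¬ Determines T c (removePair (simpleFamily T) (T* ∖ₛ p* , ⁅ j* ⁆))
  ¬determines = ¬Determines-without z-admissible dichotomy p*∈T*-p₁ (p─q⊆p T* ⁅ p₁ ⁆)
    (λ pair≡ → x∈p-y⇒x≢y (subst (p* ∈_) (cong proj₁ pair≡) p*∈T*-p₁) refl)
    (subst (_< w) (sym y-pair≡1) 1<w)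
    (≤-reflexive (sym z-pair≡w))
    where
    p₁∈T* : p₁ ∈ T*
    p₁∈T* = p─q⊆p T* ⁅ p* ⁆ p₁∈T*-p*
    p*∈T*-p₁ : p* ∈ T* ∖ₛ p₁
    p*∈T*-p₁ = x∈p∧x≢y⇒x∈p-y p*∈T* (λ p*≡p₁ → x∈p-y⇒x≢y p₁∈T*-p* (sym p*≡p₁))
    y-pair≡1 : c j* - sumOn y (T* ∖ₛ p₁) ≡ 1ℚ
    y-pair≡1 = trans (cong (_- sumOn y (T* ∖ₛ p₁)) (trans c-j* (sym y-T*)))
                     (trans (sumOn-∖ₛ y p₁∈T*) (y≡1-T* p₁∈T*))
    z-pair≡w : c j* - sumOn z (T* ∖ₛ p₁) ≡ w
    z-pair≡w = trans (cong (_- sumOn z (T* ∖ₛ p₁)) (trans c-j* (sym z-T*)))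
                     (trans (sumOn-∖ₛ z p₁∈T*) (z-p p₁∈T*-p*))

≢∅⇒Nonempty : ∀ {n} {S : Subset n} → S ≢ ∅ₛ → Nonempty S
≢∅⇒Nonempty {S = S} S≢∅ with nonempty? S
... | yes nonempty = nonempty
... | no empty     = contradiction (Empty-unique empty) S≢∅

≢Pₛ⇒Nonempty∁ : ∀ {n} {S : Subset n} → S ≢ Pₛ → Nonempty (∁ S)
≢Pₛ⇒Nonempty∁ {S = S} S≢P with Finₚ.any? (λ i → ¬? (i ∈? S))
... | yes (r , r∉S) = r , x∉p⇒x∈∁p r∉S
... | no none       = contradiction (⊆-antisym (λ _ → ∈⊤) Pₛ⊆S) S≢P
  where
  Pₛ⊆S : Pₛ ⊆ S
  Pₛ⊆S {i} _ with i ∈? S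
  ... | yes i∈S = i∈S
  ... | no i∉S  = contradiction (i , i∉S) none

theorem2 : ∀ (n m : ℕ) (T : Fin m → Subset n) → Injective _≡_ _≡_ T → UnionIsAll T → ComplementCondition T → ∀ (S* : Subset n) (U* : Subset m) → InCStar T (S* , U*) → ∃ λ (c : Fin m → ℚ) → (∀ j → 0ℚ ≤ c j) × ¬ Determines T c (removePair (simpleFamily T) (S* , U*))
theorem2 n m T _ _ complement S* U* (j* , refl , S*≢∅ , S*≢P , shape) with complement j* | ≢∅⇒Nonempty S*≢∅
... | Uc , Uc-avoids , Uc-covers | p , p∈S* with shape
...   | inj₁ refl =
  let open RemovingWholeSet T j* Uc-avoids p∈S* (criticalMember T Uc-covers (≢Pₛ⇒Nonempty∁ S*≢P))
  in c , c-nonNeg , ¬determines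
...   | inj₂ (p* , p*∈T* , refl) =
  let open RemovingOnePoint T j* Uc-avoids Uc-covers p*∈T* p∈S*
  in c , c-nonNeg , ¬determines
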